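{- Let $\Phi$ be a function on CP problems $(\mathcal{R}/\mathcal{S},L)$ with $L$ a set of ground terms such that: if there are TRSs $\mathcal{R}_1,\mathcal{R}_2$ with $\mathcal{R}=\mathcal{R}_1\cup\mathcal{R}_2$, $\mathcal{R}_2$ non-collapsing, and the relative TRS $\mathcal{R}_2/(\mathcal{R}_1\cup\mathcal{S})$ is either linear and match-RT-bounded for $L$ or non-duplicating and match-raise-RT-bounded for $L$, then $\Phi(\mathcal{R}/\mathcal{S},L)=\{(\mathcal{R}_1/(\mathcal{R}_2\cup\mathcal{S}),L,f)\}$ for some such $\mathcal{R}_1,\mathcal{R}_2$, where $f(n)=n$; otherwise $\Phi(\mathcal{R}/\mathcal{S},L)=\{(\mathcal{R}/\mathcal{S},L,\mathbf{0})\}$. Then $\Phi$ is a sound CP processor.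
   Context: A relative TRS $\mathcal{A}/\mathcal{B}$ is linear (non-duplicating) if $\mathcal{A}\cup\mathcal{B}$ is; linear: no variable occurs twice in a left- or right-hand side; non-duplicating: no variable occurs more often in $r$ than in $l$; collapsing: some right-hand side is a variable. For $N\subseteq\mathbb{N}$, $\mathcal{F}_N$ has symbols $f_c$; $\mathrm{lift}_c(f)=f_c$, $\mathrm{base}(f_c)=f$, $\mathrm{height}(f_c)=c$, extended to terms, sets, TRSs. $\mathrm{FPos}(t)$: positions of function symbols; $\|t\|$: number of function symbol occurrences. $\mathrm{match}(\mathcal{A})$: rules $l'\to\mathrm{lift}_c(r)$ with $l\to r\in\mathcal{A}$, $\mathrm{base}(l')=l$, $c=1+\min\{\mathrm{height}(l'(p))\mid p\in\mathrm{FPos}(l)\}$. $\mathrm{MATCHRT}^c(\mathcal{B})$: rules $l'\to\mathrm{lift}_d(r)$ with $\mathrm{base}(l')\to r\in\mathcal{B}$, $d=\min\{c,\mathrm{height}(l'(\epsilon))\}$ if $\|\mathrm{base}(l')\|\ge\|r\|$ and $\mathrm{lift}_{\mathrm{height}(l'(\epsilon))}(\mathrm{base}(l'))=l'$, otherwise $d=\min(\{c\}\cup\{1+\mathrm{height}(l'(p))\mid p\in\mathrm{FPos}(l')\})$. $\mathrm{matchRT}(\mathcal{A}/\mathcal{B},c)=\mathrm{match}(\mathcal{A})/\mathrm{MATCHRT}^c(\mathcal{B})$. $\mathrm{Raise}(\mathcal{F})$: rules $f_c(\vec x)\to f_{c+1}(\vec x)$; $\uparrow S$: least common $\mathrm{Raise}$-reduct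 of a finite nonempty set of terms. For a TRS $\mathcal{T}$ over $\mathcal{F}_{\mathbb{N}}$, $s\rightsquigarrow_{\mathcal{T}}t$ iff there are $l\to r\in\mathcal{T}$, position $p$, context $C$, terms $s_1,\dots,s_n$ with $l=C[x_1,\dots,x_n]$ (all variable occurrences displayed), $s|_p=C[s_1,\dots,s_n]$, $\mathrm{base}(s_i)=\mathrm{base}(s_j)$ whenever $x_i=x_j$, and $t=s[r\sigma]_p$ with $\sigma(x)=\uparrow\{s_i\mid x_i=x\}$. $\rightsquigarrow_{\mathrm{matchRT}(\mathcal{A}/\mathcal{B},c)}=\rightsquigarrow^*_{\mathrm{MATCHRT}^c(\mathcal{B})}\cdot\rightsquigarrow_{\mathrm{match}(\mathcal{A})}\cdot\rightsquigarrow^*_{\mathrm{MATCHRT}^c(\mathcal{B})}$. $\mathrm{Succ}_{\to}(K)=\{t\text{ ground}\mid s\to^*t,s\in K\}$. $\mathcal{A}/\mathcal{B}$ is match-RT-bounded (match-raise-RT-bounded) for $L$ if for some $c$ all symbols in terms of $\mathrm{Succ}_{\to}(\mathrm{lift}_0(L))$ with $\to$ the relative rewrite relation of $\mathrm{matchRT}(\mathcal{A}/\mathcal{B},c)$ (resp. $\rightsquigarrow_{\mathrm{matchRT}(\mathcal{A}/\mathcal{B},c)}$) have height $\le c$. $\to_{\mathcal{A}/\mathcal{B}}=\to_{\mathcal{B}}^*\cdot\to_{\mathcal{A}}\cdot\to_{\mathcal{B}}^*$; $\mathrm{cp}(n,\to,L)=\sup\{\mathrm{dl}(t,\to)\mid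 t\in L,|t|\le n\}$. A CP processor maps a CP problem $(\mathcal{R}/\mathcal{S},L)$ to a finite set of triples $(\mathcal{R}_i/\mathcal{S}_i,L_i,f_i)$; it is sound if $\mathrm{cp}(n,\to_{\mathcal{R}/\mathcal{S}},L)=O(\sum_if_i(n)+\sum_i\mathrm{cp}(n,\to_{\mathcal{R}_i/\mathcal{S}_i},L_i))$. $\mathbf{0}$ is the zero function. -}

module Defs where

open import Level using (0ℓ)
open import Data.Nat using (ℕ; zero; suc; _+_; _*_; _≤_; _<_; _⊓_)
open import Data.Fin using (Fin; toℕ)
open import Data.Vec using (Vec; []; _∷_; lookup; tabulate; _[_]≔_)
open import Data.List using (List; []; _∷_; _++_; foldr; map; length)
open import Data.Nat.ListAction using (sum)
import Data.List as L
open import Data.List.Relation.Unary.All using (All)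
open import Data.List.Membership.Propositional using (_∈_)
open import Data.Product using (Σ; ∃; _×_; _,_; proj₁; proj₂)
open import Data.Sum using (_⊎_)
open import Relation.Nullary using (¬_)
open import Relation.Binary.PropositionalEquality using (_≡_)
open import Relation.Binary.Construct.Closure.ReflexiveTransitive using (Star)

data Term (S : Set) (ar : S → ℕ) : Set where
  var : ℕ → Term S ar
  fun : (f : S) → Vec (Term S ar) (ar f) → Term S ar

Rel : Set → Set₁
Rel A = A → A → Set

_⨾_ : {A : Set} → Rel A → Rel A → Rel A
(R ⨾ Q) x z = ∃ λ y → R x y × Q y z

Iter : {A : Set} → Rel A → ℕ → Rel A
Iter R zero x y = x ≡ y
Iter R (suc k) x y = ∃ λ z → R x z × Iter R k z y

module Terms (S : Set) (ar : S → ℕ) where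

  T : Set
  T = Term S ar

  mutual
    _⟨_⟩ : T → (ℕ → T) → T
    var x ⟨ σ ⟩ = σ x
    fun f ts ⟨ σ ⟩ = fun f (substs ts σ)

    substs : ∀ {n} → Vec T n → (ℕ → T) → Vec T n
    substs [] σ = []
    substs (t ∷ ts) σ = (t ⟨ σ ⟩) ∷ substs ts σ

  mutual
    size : T → ℕ
    size (var x) = 1
    size (fun f ts) = suc (sizes ts)

    sizes : ∀ {n} → Vec T n → ℕ
    sizes [] = 0
    sizes (t ∷ ts) = size t + sizes ts

  mutual
    fsize : T → ℕ
    fsize (var x) = 0
    fsize (fun f ts) = suc (fsizes ts)

    fsizes : ∀ {n} → Vec T n → ℕ
    fsizes [] = 0
    fsizes (t ∷ ts) = fsize t + fsizes ts

  mutual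
    occ : ℕ → T → ℕ
    occ x (var y) with x Data.Nat.≟ y
    ... | Relation.Nullary.yes _ = 1
    ... | Relation.Nullary.no _ = 0
    occ x (fun f ts) = occs x ts

    occs : ∀ {n} → ℕ → Vec T n → ℕ
    occs x [] = 0
    occs x (t ∷ ts) = occ x t + occs x ts

  data Ground : T → Set where
    gfun : ∀ {f ts} → (∀ i → Ground (lookup ts i)) → Ground (fun f ts)

  Rule : Set
  Rule = T × T

  TRS : Set
  TRS = List Rule

  -- rule sets as predicates (possibly infinite)
  RuleSet : Set₁
  RuleSet = T → T → Set

  rules : TRS → RuleSet
  rules R l r = (l , r) ∈ R

  IsTRS : TRS → Set
  IsTRS R = ∀ {l r} → (l , r) ∈ R →
    (∀ x → ¬ (l ≡ var x)) × (∀ x → 0 < occ x r → 0 < occ x l)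

  Linear : TRS → Set
  Linear R = ∀ {l r} → (l , r) ∈ R → ∀ x → occ x l ≤ 1 × occ x r ≤ 1

  NonDuplicating : TRS → Set
  NonDuplicating R = ∀ {l r} → (l , r) ∈ R → ∀ x → occ x r ≤ occ x l

  NonCollapsing : TRS → Set
  NonCollapsing R = ∀ {l r} → (l , r) ∈ R → ∀ x → ¬ (r ≡ var x)

  data Ctx (Root : Rel T) : Rel T where
    root : ∀ {s t} → Root s t → Ctx Root s t
    cong : ∀ {f} {ts : Vec T (ar f)} (i : Fin (ar f)) {t} →
           Ctx Root (lookup ts i) t → Ctx Root (fun f ts) (fun f (ts [ i ]≔ t))

  RootStep : RuleSet → Rel T
  RootStep Rs s t = ∃ λ l → ∃ λ r → Rs l r × ∃ λ (σ : ℕ → T) →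
    s ≡ l ⟨ σ ⟩ × t ≡ r ⟨ σ ⟩

  Step : RuleSet → Rel T
  Step Rs = Ctx (RootStep Rs)

  _∪ʳ_ : RuleSet → RuleSet → RuleSet
  (A ∪ʳ B) l r = A l r ⊎ B l r

  RelStep : Rel T → Rel T → Rel T
  RelStep A B = Star B ⨾ (A ⨾ Star B)

  SuccSat : Rel T → (T → Set) → (T → Set) → Set
  SuccSat R K Q = ∀ s t → K s → Star R s t → Ground t → Q t



record Signature : Set₁ where
  field
    Sym : Set
    arity : Sym → ℕ

module Over (Sig : Signature) where
  open Signature Sig

  Tm : Set
  Tm = Term Sym arity

  LSym : Set
  LSym = Sym × ℕ

  larity : LSym → ℕ
  larity p = arity (proj₁ p)

  LTm : Set
  LTm = Term LSym larity

  module B = Terms Sym arity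
  module Lt = Terms LSym larity

  mutual
    lift : ℕ → Tm → LTm
    lift c (var x) = var x
    lift c (fun f ts) = fun (f , c) (lifts c ts)

    lifts : ∀ {n} → ℕ → Vec Tm n → Vec LTm n
    lifts c [] = []
    lifts c (t ∷ ts) = lift c t ∷ lifts c ts

  mutual
    base : LTm → Tm
    base (var x) = var x
    base (fun (f , c) ts) = fun f (bases ts)

    bases : ∀ {n} → Vec LTm n → Vec Tm n
    bases [] = []
    bases (t ∷ ts) = base t ∷ bases ts

  mutual
    heights : LTm → List ℕ
    heights (var x) = []
    heights (fun (f , c) ts) = c ∷ heightss ts

    heightss : ∀ {n} → Vec LTm n → List ℕ
    heightss [] = []
    heightss (t ∷ ts) = heights t L.++ heightss ts

  -- height of the root symbol (only used for non-variable terms)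
  rootHeight : LTm → ℕ
  rootHeight (var x) = 0
  rootHeight (fun (f , c) ts) = c

  -- min { height(t(p)) | p ∈ FPos(t) } (only used for non-variable t)
  minHeight : LTm → ℕ
  minHeight (var x) = 0
  minHeight (fun (f , c) ts) = foldr _⊓_ c (heightss ts)

  HeightsBoundedBy : ℕ → LTm → Set
  HeightsBoundedBy c t = All (_≤ c) (heights t)

  Match : B.TRS → Lt.RuleSet
  Match A l' r' = ∃ λ r → (base l' , r) ∈ A × r' ≡ lift (suc (minHeight l')) r

  MatchRTHeight : ℕ → LTm → Tm → ℕ → Set
  MatchRTHeight c l' r d =
      ((B.fsize (base l') Data.Nat.≥ B.fsize r × lift (rootHeight l') (base l') ≡ l')
         × d ≡ c ⊓ rootHeight l')
    ⊎ (¬ (B.fsize (base l') Data.Nat.≥ B.fsize r × lift (rootHeight l') (base l') ≡ l')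
         × d ≡ foldr _⊓_ c (map suc (heights l')))

  MATCHRT : ℕ → B.TRS → Lt.RuleSet
  MATCHRT c Bs l' r' = ∃ λ r → (base l' , r) ∈ Bs × ∃ λ d →
    MatchRTHeight c l' r d × r' ≡ lift d r

  MatchRTStep : B.TRS → B.TRS → ℕ → Rel LTm
  MatchRTStep A Bs c = Lt.RelStep (Lt.Step (Match A)) (Lt.Step (MATCHRT c Bs))

  Lift0 : (Tm → Set) → LTm → Set
  Lift0 L s = ∃ λ t → L t × s ≡ lift 0 t

  MatchRTBounded : B.TRS → B.TRS → (Tm → Set) → Set
  MatchRTBounded A Bs L = ∃ λ c →
    Lt.SuccSat (MatchRTStep A Bs c) (Lift0 L) (HeightsBoundedBy c)

  RaiseRules : Lt.RuleSet
  RaiseRules l r = ∃ λ f → ∃ λ c →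
    l ≡ fun (f , c) (tabulate (λ i → var (toℕ i))) ×
    r ≡ fun (f , suc c) (tabulate (λ i → var (toℕ i)))

  RaiseStar : Rel LTm
  RaiseStar = Star (Lt.Step RaiseRules)

  LeastCommonRaiseReduct : (LTm → Set) → LTm → Set
  LeastCommonRaiseReduct P v =
    (∀ u → P u → RaiseStar u v) ×
    (∀ w → (∀ u → P u → RaiseStar u w) → RaiseStar v w)

  -- s has the shape of l: s = C[s_1,…,s_n] where l = C[x_1,…,x_n]
  data Fits : LTm → LTm → Set where
    fvar : ∀ {x u} → Fits (var x) u
    ffun : ∀ {f} {ts us : Vec LTm (larity f)} →
           (∀ i → Fits (lookup ts i) (lookup us i)) → Fits (fun f ts) (fun f us)

  -- Occ l s x u : some occurrence x_i = x of l is matched by s_i = u in s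
  data Occ : LTm → LTm → ℕ → LTm → Set where
    ovar : ∀ {x u} → Occ (var x) u x u
    ofun : ∀ {f} {ts us : Vec LTm (larity f)} {x u} (i : Fin (larity f)) →
           Occ (lookup ts i) (lookup us i) x u → Occ (fun f ts) (fun f us) x u

  RaiseRootStep : Lt.RuleSet → Rel LTm
  RaiseRootStep Rs s t = ∃ λ l → ∃ λ r → Rs l r × Fits l s ×
    (∀ x u₁ u₂ → Occ l s x u₁ → Occ l s x u₂ → base u₁ ≡ base u₂) ×
    ∃ λ (σ : ℕ → LTm) →
      (∀ x u → Occ l s x u → LeastCommonRaiseReduct (λ v → Occ l s x v) (σ x)) ×
      t ≡ Lt._⟨_⟩ r σ

  RaiseStep : Lt.RuleSet → Rel LTm
  RaiseStep Rs = Lt.Ctx (RaiseRootStep Rs)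

  MatchRaiseRTStep : B.TRS → B.TRS → ℕ → Rel LTm
  MatchRaiseRTStep A Bs c =
    Lt.RelStep (RaiseStep (Match A)) (RaiseStep (MATCHRT c Bs))

  MatchRaiseRTBounded : B.TRS → B.TRS → (Tm → Set) → Set
  MatchRaiseRTBounded A Bs L = ∃ λ c →
    Lt.SuccSat (MatchRaiseRTStep A Bs c) (Lift0 L) (HeightsBoundedBy c)

  record CPProblem : Set₁ where
    constructor ⟨_/_,_⟩
    field
      R : B.TRS
      S : B.TRS
      L : Tm → Set

  record Output : Set₁ where
    constructor ⟪_,_⟫
    field
      prob : CPProblem
      f : ℕ → ℕ

  RelRew : B.TRS → B.TRS → Rel Tm
  RelRew R S = B.RelStep (B.Step (B.rules R)) (B.Step (B.rules S))

  CpBoundedBy : CPProblem → ℕ → ℕ → Set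
  CpBoundedBy ⟨ R / S , L ⟩ n b =
    ∀ t → L t → B.size t ≤ n → ∀ k u → Iter (RelRew R S) k t u → k ≤ b

  ValidProblem : CPProblem → Set
  ValidProblem ⟨ R / S , L ⟩ = B.IsTRS R × B.IsTRS S × (∀ t → L t → B.Ground t)

  -- cp(n,→_{R/S},L) = O(Σ_i f_i(n) + Σ_i cp(n,→_{R_i/S_i},L_i))
  -- (values in ℕ ∪ {∞}; quantifying over all finite upper bounds b_i of the
  --  sub-problem complexities makes the inequality vacuous if one is ∞)
  SoundFor : CPProblem → List Output → Set
  SoundFor P outs = ∃ λ C → ∃ λ N → ∀ n → N ≤ n →
    ∀ (b : Fin (length outs) → ℕ) →
    (∀ i → CpBoundedBy (Output.prob (L.lookup outs i)) n (b i)) →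
    CpBoundedBy P n
      (C * (sum (map (λ o → Output.f o n) outs) + sum (L.tabulate b)))

  Processor : Set₁
  Processor = CPProblem → List Output

  SoundProcessor : Processor → Set₁
  SoundProcessor Φ = ∀ P → ValidProblem P → SoundFor P (Φ P)

  _≐_∪_ : B.TRS → B.TRS → B.TRS → Set
  R ≐ R₁ ∪ R₂ = ∀ ρ → ((ρ ∈ R → ρ ∈ R₁ ⊎ ρ ∈ R₂) × (ρ ∈ R₁ ⊎ ρ ∈ R₂ → ρ ∈ R))

  SplitCond : CPProblem → B.TRS → B.TRS → Set
  SplitCond ⟨ R / S , L ⟩ R₁ R₂ =
    R ≐ R₁ ∪ R₂ × B.NonCollapsing R₂ ×
    ((B.Linear (R₂ ++ (R₁ ++ S)) × MatchRTBounded R₂ (R₁ ++ S) L)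
     ⊎ (B.NonDuplicating (R₂ ++ (R₁ ++ S)) × MatchRaiseRTBounded R₂ (R₁ ++ S) L))

  IsMatchRTProcessor : Processor → Set₁
  IsMatchRTProcessor Φ = ∀ P → ValidProblem P →
      (∃ λ R₁ → ∃ λ R₂ → SplitCond P R₁ R₂ ×
         Φ P ≡ ⟪ ⟨ R₁ / R₂ ++ CPProblem.S P , CPProblem.L P ⟩ , (λ n → n) ⟫ ∷ [])
    ⊎ ((¬ ∃ λ R₁ → ∃ λ R₂ → SplitCond P R₁ R₂) ×
         Φ P ≡ ⟪ P , (λ n → 0) ⟫ ∷ [])

module Submission where

-- If Φ returns {(P, 0)} soundness is trivial.  Otherwise R = R₁ ∪ R₂ and every
-- →_{R/S} derivation of length k from t splits into a R₁-steps, which form an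
-- R₁/(R₂ ∪ S) derivation, and b R₂-steps, so k = a + b with a ≤ cp(n,R₁/(R₂∪S))
-- and it remains to show b = O(|t|).  To this end the derivation is followed on
-- lifted terms, starting from lift₀(t): R₂-steps lift to match(R₂)-steps and
-- R₁/S-steps to MATCHRT^c(R₁ ∪ S)-steps (ordinary steps for linear systems,
-- ⇝-steps using least common Raise-reducts for non-duplicating ones).  By the
-- boundedness hypothesis all lifted terms have height ≤ c, and the weight
-- W(t) = Σ_p w(height(t(p))) with w(h) = tower(c ∸ h) strictly decreases in
-- match steps and never increases in MATCHRT steps.  Hence b ≤ W(lift₀ t) =
-- ‖t‖·w(0).

open import Defs
open import Data.Nat using (ℕ; zero; suc; _+_; _*_; _≤_; _<_; _⊓_; _⊔_; _∸_; z≤n; s≤s; _≟_; _<?_; _≤?_)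
open import Data.Nat.Properties
open import Algebra.Properties.CommutativeSemigroup +-commutativeSemigroup using (interchange; x∙yz≈y∙xz; xy∙z≈xz∙y)
open import Function using (_∘_)
open import Data.Fin using (Fin; toℕ) renaming (zero to fz; suc to fs)
open import Data.Vec using (Vec; []; _∷_; lookup; tabulate; _[_]≔_)
import Data.Vec.Properties as VP
open import Data.List using (List; []; _∷_; _++_; length; foldr; map)
import Data.List.Properties as LP
open import Data.List.Membership.Propositional using (_∈_)
open import Data.List.Membership.Propositional.Properties using (∈-++⁺ˡ; ∈-++⁺ʳ; ∈-++⁻)
open import Data.List.Relation.Unary.Any using (here; there)
open import Data.List.Relation.Unary.All using (All; []; _∷_; all?; universal)
import Data.List.Relation.Unary.All as All
open import Data.List.Relation.Unary.All.Properties using (++⁺; ++⁻ˡ; ++⁻ʳ)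
open import Data.Product using (Σ; ∃; _×_; _,_; proj₁; proj₂; map₂)
open import Data.Sum using (_⊎_; inj₁; inj₂) renaming (map to ⊎-map)
open import Data.Unit using (⊤; tt)
open import Data.Empty using (⊥-elim)
open import Relation.Nullary using (¬_; yes; no; Dec)
open import Relation.Nullary.Decidable using (_×-dec_)
open import Relation.Binary.PropositionalEquality using (_≡_; refl; sym; trans; cong; cong₂; subst; subst₂; module ≡-Reasoning)
open import Relation.Binary.Construct.Closure.ReflexiveTransitive using (Star; ε; _◅_; _◅◅_; gmap)

module TermFacts (S : Set) (ar : S → ℕ) where
  open Terms S ar hiding (cong)

  mutual
    vars : T → List ℕ
    vars (var x) = x ∷ []
    vars (fun f ts) = varss ts

    varss : ∀ {n} → Vec T n → List ℕ
    varss [] = []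
    varss (t ∷ ts) = vars t ++ varss ts

  indicator : ℕ → ℕ → ℕ
  indicator x y with x ≟ y
  ... | yes _ = 1
  ... | no _ = 0

  count : ℕ → List ℕ → ℕ
  count x [] = 0
  count x (y ∷ ys) = indicator x y + count x ys

  indicator-refl : ∀ x → indicator x x ≡ 1
  indicator-refl x with x ≟ x
  ... | yes _ = refl
  ... | no x≢x = ⊥-elim (x≢x refl)

  count-++ : ∀ x xs ys → count x (xs ++ ys) ≡ count x xs + count x ys
  count-++ x [] ys = refl
  count-++ x (y ∷ xs) ys = trans (cong (indicator x y +_) (count-++ x xs ys)) (sym (+-assoc (indicator x y) _ _))

  mutual
    occ≡count : ∀ x t → occ x t ≡ count x (vars t)
    occ≡count x (var y) with x ≟ y
    ... | yes _ = refl
    ... | no _ = refl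
    occ≡count x (fun f ts) = occs≡count x ts

    occs≡count : ∀ {n} x (ts : Vec T n) → occs x ts ≡ count x (varss ts)
    occs≡count x [] = refl
    occs≡count x (t ∷ ts) =
      trans (cong₂ _+_ (occ≡count x t) (occs≡count x ts)) (sym (count-++ x (vars t) (varss ts)))

  occ-var-self : ∀ x → occ x (var x) ≡ 1
  occ-var-self x = trans (occ≡count x (var x)) (trans (+-identityʳ _) (indicator-refl x))

  weightSum : (ℕ → ℕ) → List ℕ → ℕ
  weightSum φ [] = 0
  weightSum φ (x ∷ xs) = φ x + weightSum φ xs

  weightSum-++ : ∀ φ xs ys → weightSum φ (xs ++ ys) ≡ weightSum φ xs + weightSum φ ys
  weightSum-++ φ [] ys = refl
  weightSum-++ φ (x ∷ xs) ys =
    trans (cong (φ x +_) (weightSum-++ φ xs ys)) (sym (+-assoc (φ x) _ _))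

  extract : ∀ φ x ys → 0 < count x ys → Σ (List ℕ) λ ys' →
            weightSum φ ys ≡ φ x + weightSum φ ys' × (∀ z → count z ys ≡ count z (x ∷ ys'))
  extract φ x [] ()
  extract φ x (y ∷ ys) x∈ys with x ≟ y
  ... | yes refl = ys , refl , (λ z → refl)
  ... | no _ with extract φ x ys x∈ys
  ... | ys' , sum-eq , count-eq =
    y ∷ ys' , swap (φ y) (φ x) sum-eq , λ z → swap (indicator z y) (indicator z x) (count-eq z)
    where
    swap : ∀ a b {c e} → c ≡ b + e → a + c ≡ b + (a + e)
    swap a b {e = e} refl = x∙yz≈y∙xz a b e

  count-head : ∀ x xs → 0 < count x (x ∷ xs)
  count-head x xs = subst (λ k → 1 ≤ k + count x xs) (sym (indicator-refl x)) (s≤s z≤n)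

  weightSum-mono : ∀ φ xs ys → (∀ x → count x xs ≤ count x ys) → weightSum φ xs ≤ weightSum φ ys
  weightSum-mono φ [] ys sub = z≤n
  weightSum-mono φ (x ∷ xs) ys sub with extract φ x ys (≤-trans (count-head x xs) (sub x))
  ... | ys' , sum-eq , count-eq =
    subst (φ x + weightSum φ xs ≤_) (sym sum-eq) (+-monoʳ-≤ (φ x) (weightSum-mono φ xs ys' sub'))
    where
    sub' : ∀ z → count z xs ≤ count z ys'
    sub' z = +-cancelˡ-≤ (indicator z x) _ _ (subst (indicator z x + count z xs ≤_) (count-eq z) (sub z))

  varWeight : T → (ℕ → ℕ) → ℕ
  varWeight t φ = weightSum φ (vars t)

  varWeight-nonDup : ∀ r l φ → (∀ x → occ x r ≤ occ x l) → varWeight r φ ≤ varWeight l φ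
  varWeight-nonDup r l φ nd =
    weightSum-mono φ (vars r) (vars l) (λ x → subst₂ _≤_ (occ≡count x r) (occ≡count x l) (nd x))

  +-positive : ∀ a b → 0 < a + b → 0 < a ⊎ 0 < b
  +-positive zero b p = inj₂ p
  +-positive (suc a) b p = inj₁ (s≤s z≤n)

  mutual
    ground-subst⁻ : ∀ t σ x → Ground (t ⟨ σ ⟩) → 0 < occ x t → Ground (σ x)
    ground-subst⁻ (var y) σ x g p with x ≟ y
    ground-subst⁻ (var y) σ x g p | yes refl = g
    ground-subst⁻ (var y) σ x g () | no _
    ground-subst⁻ (fun f ts) σ x (gfun g) p = grounds-subst⁻ ts σ x g p

    grounds-subst⁻ : ∀ {n} (ts : Vec T n) σ x → (∀ i → Ground (lookup (substs ts σ) i)) →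
                     0 < occs x ts → Ground (σ x)
    grounds-subst⁻ [] σ x g ()
    grounds-subst⁻ (t ∷ ts) σ x g p with +-positive (occ x t) (occs x ts) p
    ... | inj₁ q = ground-subst⁻ t σ x (g fz) q
    ... | inj₂ q = grounds-subst⁻ ts σ x (λ i → g (fs i)) q

  mutual
    ground-subst : ∀ t σ → (∀ x → 0 < occ x t → Ground (σ x)) → Ground (t ⟨ σ ⟩)
    ground-subst (var y) σ h = h y (subst (0 <_) (sym (occ-var-self y)) (s≤s z≤n))
    ground-subst (fun f ts) σ h = gfun (grounds-subst ts σ h)

    grounds-subst : ∀ {n} (ts : Vec T n) σ → (∀ x → 0 < occs x ts → Ground (σ x)) →
                    ∀ i → Ground (lookup (substs ts σ) i)
    grounds-subst (t ∷ ts) σ h fz = ground-subst t σ (λ x p → h x (≤-trans p (m≤m+n _ _)))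
    grounds-subst (t ∷ ts) σ h (fs i) = grounds-subst ts σ (λ x p → h x (≤-trans p (m≤n+m _ (occ x t)))) i

  ground-update : ∀ {n} (ts : Vec T n) i t → (∀ j → Ground (lookup ts j)) → Ground t →
                  ∀ j → Ground (lookup (ts [ i ]≔ t) j)
  ground-update (u ∷ ts) fz t g gt fz = gt
  ground-update (u ∷ ts) fz t g gt (fs j) = g (fs j)
  ground-update (u ∷ ts) (fs i) t g gt fz = g fz
  ground-update (u ∷ ts) (fs i) t g gt (fs j) = ground-update ts i t (λ k → g (fs k)) gt j

  ground-ctx : ∀ {Root : Rel T} → (∀ {s t} → Ground s → Root s t → Ground t) →
               ∀ {s t} → Ground s → Ctx Root s t → Ground t
  ground-ctx h g (root r) = h g r
  ground-ctx h (gfun g) (Terms.cong {ts = ts} i st) = gfun (ground-update ts i _ g (ground-ctx h (g i) st))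

  ground-step : ∀ R → IsTRS R → ∀ {s t} → Ground s → Step (rules R) s t → Ground t
  ground-step R trs = ground-ctx root-step
    where
    root-step : ∀ {s t} → Ground s → RootStep (rules R) s t → Ground t
    root-step g (l , r , lr , σ , refl , refl) =
      ground-subst r σ (λ x p → ground-subst⁻ l σ x g (proj₂ (trs lr) x p))

  ctx-map : ∀ {R₁ R₂ : Rel T} → (∀ {s t} → R₁ s t → R₂ s t) → ∀ {s t} → Ctx R₁ s t → Ctx R₂ s t
  ctx-map h (root r) = root (h r)
  ctx-map h (Terms.cong i st) = Terms.cong i (ctx-map h st)

  ctx-split : ∀ {R₀ R₁ R₂ : Rel T} → (∀ {s t} → R₀ s t → R₁ s t ⊎ R₂ s t) →
              ∀ {s t} → Ctx R₀ s t → Ctx R₁ s t ⊎ Ctx R₂ s t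
  ctx-split h (root r) with h r
  ... | inj₁ a = inj₁ (root a)
  ... | inj₂ b = inj₂ (root b)
  ctx-split h (Terms.cong i st) with ctx-split h st
  ... | inj₁ a = inj₁ (Terms.cong i a)
  ... | inj₂ b = inj₂ (Terms.cong i b)

  step-⊆ : ∀ {R R' : TRS} → (∀ {ρ} → ρ ∈ R → ρ ∈ R') → ∀ {s t} → Step (rules R) s t → Step (rules R') s t
  step-⊆ sub = ctx-map λ { (l , r , m , σ , e₁ , e₂) → l , r , sub m , σ , e₁ , e₂ }

  isTRS-++ : ∀ {R R'} → IsTRS R → IsTRS R' → IsTRS (R ++ R')
  isTRS-++ {R} trs trs' m with ∈-++⁻ R m
  ... | inj₁ m₁ = trs m₁
  ... | inj₂ m₂ = trs' m₂

  linear⇒nonDuplicating : ∀ {R} → IsTRS R → Linear R → NonDuplicating R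
  linear⇒nonDuplicating trs lin {l} {r} m x with occ x r in eq
  ... | zero = z≤n
  ... | suc k = ≤-trans (subst (_≤ 1) eq (proj₂ (lin m x))) (proj₂ (trs m) x (subst (0 <_) (sym eq) (s≤s z≤n)))

  maxRhsSize : TRS → ℕ
  maxRhsSize [] = 0
  maxRhsSize ((l , r) ∷ R) = fsize r ⊔ maxRhsSize R

  rhsSize≤max : ∀ {R l r} → (l , r) ∈ R → fsize r ≤ maxRhsSize R
  rhsSize≤max (here refl) = m≤m⊔n _ _
  rhsSize≤max {(_ , r') ∷ R} (there m) = ≤-trans (rhsSize≤max {R} m) (m≤n⊔m (fsize r') _)

  mutual
    fsize≤size : ∀ t → fsize t ≤ size t
    fsize≤size (var x) = z≤n
    fsize≤size (fun f ts) = s≤s (fsizes≤sizes ts)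

    fsizes≤sizes : ∀ {n} (ts : Vec T n) → fsizes ts ≤ sizes ts
    fsizes≤sizes [] = z≤n
    fsizes≤sizes (t ∷ ts) = +-mono-≤ (fsize≤size t) (fsizes≤sizes ts)

module Lifting (Sig : Signature) where
  open Signature Sig
  open Over Sig
  module FB = TermFacts Sym arity
  module FL = TermFacts LSym larity

  mutual
    base-lift : ∀ c t → base (lift c t) ≡ t
    base-lift c (var x) = refl
    base-lift c (fun f ts) = cong (fun f) (bases-lifts c ts)

    bases-lifts : ∀ {n} c (ts : Vec Tm n) → bases (lifts c ts) ≡ ts
    bases-lifts c [] = refl
    bases-lifts c (t ∷ ts) = cong₂ _∷_ (base-lift c t) (bases-lifts c ts)

  lookup-bases : ∀ {n} (ts : Vec LTm n) i → lookup (bases ts) i ≡ base (lookup ts i)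
  lookup-bases (t ∷ ts) fz = refl
  lookup-bases (t ∷ ts) (fs i) = lookup-bases ts i

  bases-update : ∀ {n} (ss : Vec LTm n) i x → bases (ss [ i ]≔ x) ≡ bases ss [ i ]≔ base x
  bases-update (s ∷ ss) fz x = refl
  bases-update (s ∷ ss) (fs i) x = cong (base s ∷_) (bases-update ss i x)

  base-fun⁻ : ∀ {f g} {ss : Vec LTm (arity g)} {ts : Vec Tm (arity f)} →
              fun g (bases ss) ≡ fun f ts → Σ (g ≡ f) λ { refl → bases ss ≡ ts }
  base-fun⁻ refl = refl , refl

  mutual
    ground-base⁻ : ∀ t → B.Ground (base t) → Lt.Ground t
    ground-base⁻ (var x) ()
    ground-base⁻ (fun (f , c) ts) (B.gfun g) = Lt.gfun (grounds-base⁻ ts g)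

    grounds-base⁻ : ∀ {n} (ts : Vec LTm n) → (∀ i → B.Ground (lookup (bases ts) i)) →
                    ∀ i → Lt.Ground (lookup ts i)
    grounds-base⁻ (t ∷ ts) g fz = ground-base⁻ t (g fz)
    grounds-base⁻ (t ∷ ts) g (fs i) = grounds-base⁻ ts (λ j → g (fs j)) i

  mutual
    occ-base : ∀ x t → Lt.occ x t ≡ B.occ x (base t)
    occ-base x (var y) with x ≟ y
    ... | yes _ = refl
    ... | no _ = refl
    occ-base x (fun (f , c) ts) = occs-base x ts

    occs-base : ∀ {n} x (ts : Vec LTm n) → Lt.occs x ts ≡ B.occs x (bases ts)
    occs-base x [] = refl
    occs-base x (t ∷ ts) = cong₂ _+_ (occ-base x t) (occs-base x ts)

  occ-lift : ∀ x d t → Lt.occ x (lift d t) ≡ B.occ x t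
  occ-lift x d t = trans (occ-base x (lift d t)) (cong (B.occ x) (base-lift d t))

  mutual
    heights-lift : ∀ h t → All (_≡ h) (heights (lift h t))
    heights-lift h (var x) = []
    heights-lift h (fun f ts) = refl ∷ heights-lifts h ts

    heights-lifts : ∀ {n} h (ts : Vec Tm n) → All (_≡ h) (heightss (lifts h ts))
    heights-lifts h [] = []
    heights-lifts h (t ∷ ts) = ++⁺ (heights-lift h t) (heights-lifts h ts)

  mutual
    lift-base-uniform : ∀ h t → All (_≡ h) (heights t) → lift h (base t) ≡ t
    lift-base-uniform h (var x) a = refl
    lift-base-uniform h (fun (f , c) ts) (refl ∷ a) = cong (fun (f , h)) (lifts-bases-uniform h ts a)

    lifts-bases-uniform : ∀ {n} h (ts : Vec LTm n) → All (_≡ h) (heightss ts) → lifts h (bases ts) ≡ ts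
    lifts-bases-uniform h [] a = refl
    lifts-bases-uniform h (t ∷ ts) a =
      cong₂ _∷_ (lift-base-uniform h t (++⁻ˡ (heights t) a)) (lifts-bases-uniform h ts (++⁻ʳ (heights t) a))

  uniform? : ∀ h t → Dec (lift h (base t) ≡ t)
  uniform? h t with all? (_≟ h) (heights t)
  ... | yes a = yes (lift-base-uniform h t a)
  ... | no ¬a = no (λ e → ¬a (subst (λ u → All (_≡ h) (heights u)) e (heights-lift h (base t))))

  heights-update : ∀ {P : ℕ → Set} {n} (ts : Vec LTm n) i t → All P (heightss (ts [ i ]≔ t)) → All P (heights t)
  heights-update (x ∷ ts) fz t a = ++⁻ˡ (heights t) a
  heights-update (x ∷ ts) (fs i) t a = heights-update ts i t (++⁻ʳ (heights x) a)

  mutual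
    base-lift-subst : ∀ d t σ' σ → (∀ x → 0 < B.occ x t → base (σ' x) ≡ σ x) →
                      base (lift d t Lt.⟨ σ' ⟩) ≡ t B.⟨ σ ⟩
    base-lift-subst d (var y) σ' σ h = h y (subst (0 <_) (sym (FB.occ-var-self y)) (s≤s z≤n))
    base-lift-subst d (fun f ts) σ' σ h = cong (fun f) (bases-lifts-subst d ts σ' σ h)

    bases-lifts-subst : ∀ {n} d (ts : Vec Tm n) σ' σ → (∀ x → 0 < B.occs x ts → base (σ' x) ≡ σ x) →
                        bases (Lt.substs (lifts d ts) σ') ≡ B.substs ts σ
    bases-lifts-subst d [] σ' σ h = refl
    bases-lifts-subst d (t ∷ ts) σ' σ h =
      cong₂ _∷_ (base-lift-subst d t σ' σ (λ x p → h x (≤-trans p (m≤m+n _ _))))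
                (bases-lifts-subst d ts σ' σ (λ x p → h x (≤-trans p (m≤n+m _ (B.occ x t)))))

module Weights (Sig : Signature) (w : ℕ → ℕ) where
  open Signature Sig
  open Over Sig
  open Lifting Sig

  W : LTm → ℕ
  W t = FL.weightSum w (heights t)

  Ws : ∀ {n} → Vec LTm n → ℕ
  Ws ts = FL.weightSum w (heightss ts)

  Ws-∷ : ∀ {n} t (ts : Vec LTm n) → Ws (t ∷ ts) ≡ W t + Ws ts
  Ws-∷ t ts = FL.weightSum-++ w (heights t) (heightss ts)

  mutual
    W-lift : ∀ d t → W (lift d t) ≡ B.fsize t * w d
    W-lift d (var x) = refl
    W-lift d (fun f ts) = cong (w d +_) (Ws-lifts d ts)

    Ws-lifts : ∀ {n} d (ts : Vec Tm n) → Ws (lifts d ts) ≡ B.fsizes ts * w d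
    Ws-lifts d [] = refl
    Ws-lifts d (t ∷ ts) = begin
      Ws (lift d t ∷ lifts d ts)               ≡⟨ Ws-∷ (lift d t) (lifts d ts) ⟩
      W (lift d t) + Ws (lifts d ts)           ≡⟨ cong₂ _+_ (W-lift d t) (Ws-lifts d ts) ⟩
      B.fsize t * w d + B.fsizes ts * w d      ≡⟨ *-distribʳ-+ (w d) (B.fsize t) (B.fsizes ts) ⟨
      (B.fsize t + B.fsizes ts) * w d          ∎
      where open ≡-Reasoning

  mutual
    W-subst : ∀ t σ → W (t Lt.⟨ σ ⟩) ≡ W t + FL.varWeight t (W ∘ σ)
    W-subst (var x) σ = sym (+-identityʳ (W (σ x)))
    W-subst (fun (f , c) ts) σ = trans (cong (w c +_) (Ws-subst ts σ)) (sym (+-assoc (w c) _ _))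

    Ws-subst : ∀ {n} (ts : Vec LTm n) σ → Ws (Lt.substs ts σ) ≡ Ws ts + FL.weightSum (W ∘ σ) (FL.varss ts)
    Ws-subst [] σ = refl
    Ws-subst (t ∷ ts) σ = begin
      Ws (t Lt.⟨ σ ⟩ ∷ Lt.substs ts σ)                       ≡⟨ Ws-∷ (t Lt.⟨ σ ⟩) (Lt.substs ts σ) ⟩
      W (t Lt.⟨ σ ⟩) + Ws (Lt.substs ts σ)                   ≡⟨ cong₂ _+_ (W-subst t σ) (Ws-subst ts σ) ⟩
      (W t + FL.varWeight t (W ∘ σ)) + (Ws ts + Σσ ts)       ≡⟨ interchange (W t) _ (Ws ts) _ ⟩
      (W t + Ws ts) + (FL.varWeight t (W ∘ σ) + Σσ ts)       ≡⟨ cong₂ _+_ (Ws-∷ t ts)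
                                                                  (FL.weightSum-++ (W ∘ σ) (FL.vars t) (FL.varss ts)) ⟨
      Ws (t ∷ ts) + Σσ (t ∷ ts)                              ∎
      where
      open ≡-Reasoning
      Σσ : ∀ {m} → Vec LTm m → ℕ
      Σσ us = FL.weightSum (W ∘ σ) (FL.varss us)

  mutual
    W-fits : ∀ {l s} (φ : ℕ → ℕ) → Fits l s → (∀ x u → Occ l s x u → φ x ≤ W u) →
             W l + FL.varWeight l φ ≤ W s
    W-fits {var x} {s} φ fvar h = subst (_≤ W s) (sym (+-identityʳ (φ x))) (h x s ovar)
    W-fits {fun (f , c) ts} {fun _ us} φ (ffun fits) h =
      subst (_≤ w c + Ws us) (sym (+-assoc (w c) _ _))
        (+-monoʳ-≤ (w c) (Ws-fits φ ts us fits (λ x u i o → h x u (ofun i o))))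

    Ws-fits : ∀ {n} (φ : ℕ → ℕ) (ts us : Vec LTm n) → (∀ i → Fits (lookup ts i) (lookup us i)) →
              (∀ x u i → Occ (lookup ts i) (lookup us i) x u → φ x ≤ W u) →
              Ws ts + FL.weightSum φ (FL.varss ts) ≤ Ws us
    Ws-fits φ [] [] fits h = z≤n
    Ws-fits φ (t ∷ ts) (u ∷ us) fits h = begin
      Ws (t ∷ ts) + FL.weightSum φ (FL.varss (t ∷ ts))
        ≡⟨ cong₂ _+_ (Ws-∷ t ts) (FL.weightSum-++ φ (FL.vars t) (FL.varss ts)) ⟩
      (W t + Ws ts) + (FL.varWeight t φ + FL.weightSum φ (FL.varss ts))
        ≡⟨ interchange (W t) (Ws ts) _ _ ⟩
      (W t + FL.varWeight t φ) + (Ws ts + FL.weightSum φ (FL.varss ts))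
        ≤⟨ +-mono-≤ (W-fits {t} {u} φ (fits fz) (λ x v o → h x v fz o))
                    (Ws-fits φ ts us (λ i → fits (fs i)) (λ x v i o → h x v (fs i) o)) ⟩
      W u + Ws us
        ≡⟨ Ws-∷ u us ⟨
      Ws (u ∷ us) ∎
      where open ≤-Reasoning

  Ws-update : ∀ {n} (ts : Vec LTm n) i t → Ws (ts [ i ]≔ t) + W (lookup ts i) ≡ Ws ts + W t
  Ws-update (u ∷ ts) fz t = begin
    Ws (t ∷ ts) + W u     ≡⟨ cong (_+ W u) (Ws-∷ t ts) ⟩
    (W t + Ws ts) + W u   ≡⟨ +-assoc (W t) (Ws ts) (W u) ⟩
    W t + (Ws ts + W u)   ≡⟨ +-comm (W t) _ ⟩
    (Ws ts + W u) + W t   ≡⟨ cong (_+ W t) (trans (+-comm (Ws ts) (W u)) (sym (Ws-∷ u ts))) ⟩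
    Ws (u ∷ ts) + W t     ∎
    where open ≡-Reasoning
  Ws-update (u ∷ ts) (fs i) t = begin
    Ws (u ∷ ts [ i ]≔ t) + W (lookup ts i)     ≡⟨ cong (_+ W (lookup ts i)) (Ws-∷ u (ts [ i ]≔ t)) ⟩
    (W u + Ws (ts [ i ]≔ t)) + W (lookup ts i) ≡⟨ +-assoc (W u) _ _ ⟩
    W u + (Ws (ts [ i ]≔ t) + W (lookup ts i)) ≡⟨ cong (W u +_) (Ws-update ts i t) ⟩
    W u + (Ws ts + W t)                        ≡⟨ +-assoc (W u) _ _ ⟨
    (W u + Ws ts) + W t                        ≡⟨ cong (_+ W t) (Ws-∷ u ts) ⟨
    Ws (u ∷ ts) + W t                          ∎
    where open ≡-Reasoning

  -- Weight decrease by k is closed under contexts (W is additive over positions).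
  -- The side condition on the result's heights is inherited by its subterms.
  weight-ctx : ∀ k {Q : ℕ → Set} {Root : Rel LTm} →
               (∀ {s t} → Root s t → All Q (heights t) → W t + k ≤ W s) →
               ∀ {s t} → Lt.Ctx Root s t → All Q (heights t) → W t + k ≤ W s
  weight-ctx k dec (Lt.root r) q = dec r q
  weight-ctx k {Q} dec (Lt.cong {f = (f , c)} {ts} i {t} st) (_ ∷ q) =
    subst (_≤ w c + Ws ts) (sym (+-assoc (w c) _ k)) (+-monoʳ-≤ (w c) update-decreases)
    where
    t-decreases : W t + k ≤ W (lookup ts i)
    t-decreases = weight-ctx k dec st (heights-update ts i t q)
    update-decreases : Ws (ts [ i ]≔ t) + k ≤ Ws ts
    update-decreases = +-cancelʳ-≤ (W t) _ _ (begin
      Ws (ts [ i ]≔ t) + k + W t        ≡⟨ +-assoc (Ws (ts [ i ]≔ t)) k (W t) ⟩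
      Ws (ts [ i ]≔ t) + (k + W t)      ≡⟨ cong (Ws (ts [ i ]≔ t) +_) (+-comm k (W t)) ⟩
      Ws (ts [ i ]≔ t) + (W t + k)      ≤⟨ +-monoʳ-≤ (Ws (ts [ i ]≔ t)) t-decreases ⟩
      Ws (ts [ i ]≔ t) + W (lookup ts i) ≡⟨ Ws-update ts i t ⟩
      Ws ts + W t                        ∎)
      where open ≤-Reasoning

  weight-ctx-nonincreasing : ∀ {Root : Rel LTm} → (∀ {s t} → Root s t → W t ≤ W s) →
                             ∀ {s t} → Lt.Ctx Root s t → W t ≤ W s
  weight-ctx-nonincreasing {Root} dec st =
    subst (_≤ _) (+-identityʳ _) (weight-ctx 0 {Q = λ _ → ⊤} dec₀ st (universal (λ _ → tt) _))
    where
    dec₀ : ∀ {s t} → Root s t → All (λ _ → ⊤) (heights t) → W t + 0 ≤ W s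
    dec₀ r _ = subst (_≤ _) (sym (+-identityʳ _)) (dec r)

-- A symbol of height h weighs
-- w(h) = tower(c ∸ h), where tower(e+1) = 1 + M · tower(e): a symbol of height
-- h < c outweighs M symbols of height h + 1, and symbols of height ≥ c weigh 0.
-- With M bounding the size of right-hand sides, a match step (which replaces a
-- redex by a right-hand side one level above the redex's lowest symbol)
-- strictly decreases W, while MATCHRT and Raise steps never increase it.
module Potential (Sig : Signature) (M c : ℕ) where
  open Signature Sig
  open Over Sig
  open Lifting Sig

  tower : ℕ → ℕ
  tower zero = 0
  tower (suc e) = suc (M * tower e)

  tower-mono : ∀ {e e'} → e ≤ e' → tower e ≤ tower e'
  tower-mono {zero} p = z≤n
  tower-mono {suc e} {suc e'} (s≤s p) = s≤s (*-monoʳ-≤ M (tower-mono p))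

  w : ℕ → ℕ
  w h = tower (c ∸ h)

  open Weights Sig w public

  w-below-c : ∀ h → h < c → w h ≡ suc (M * w (suc h))
  w-below-c h h<c = cong tower (sub-suc c h h<c)
    where
    sub-suc : ∀ c h → h < c → c ∸ h ≡ suc (c ∸ suc h)
    sub-suc (suc c) zero p = refl
    sub-suc (suc c) (suc h) (s≤s p) = sub-suc c h p

  w-from-c : ∀ h → c ≤ h → w h ≡ 0
  w-from-c h c≤h = cong tower (m≤n⇒m∸n≡0 c≤h)

  w-antitone : ∀ {x y} → x ≤ y → w y ≤ w x
  w-antitone x≤y = tower-mono (∸-monoʳ-≤ c x≤y)

  w-step : ∀ h → M * w (suc h) ≤ w h
  w-step h with h <? c
  ... | yes h<c = subst (M * w (suc h) ≤_) (sym (w-below-c h h<c)) (n≤1+n _)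
  ... | no h≮c = subst (λ k → M * k ≤ w h) (sym (w-from-c (suc h) (m≤n⇒m≤1+n (≮⇒≥ h≮c))))
                       (subst (_≤ w h) (sym (*-zeroʳ M)) z≤n)

  w-⊓ : ∀ x y → w (x ⊓ y) ≤ w x + w y
  w-⊓ x y with ⊓-sel x y
  ... | inj₁ e = subst (λ k → w k ≤ w x + w y) (sym e) (m≤m+n _ _)
  ... | inj₂ e = subst (λ k → w k ≤ w x + w y) (sym e) (m≤n+m _ _)

  w-c⊓ : ∀ h → w (c ⊓ h) ≡ w h
  w-c⊓ h with ≤-total c h
  ... | inj₁ c≤h = trans (cong w (m≤n⇒m⊓n≡m c≤h)) (trans (cong tower (n∸n≡0 c)) (sym (w-from-c h c≤h)))
  ... | inj₂ h≤c = cong w (m≥n⇒m⊓n≡n h≤c)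

  w-foldr-⊓ : ∀ a hs → w (foldr _⊓_ a hs) ≤ w a + FL.weightSum w hs
  w-foldr-⊓ a [] = m≤m+n _ _
  w-foldr-⊓ a (h ∷ hs) = begin
    w (h ⊓ foldr _⊓_ a hs)               ≤⟨ w-⊓ h _ ⟩
    w h + w (foldr _⊓_ a hs)             ≤⟨ +-monoʳ-≤ (w h) (w-foldr-⊓ a hs) ⟩
    w h + (w a + FL.weightSum w hs)      ≡⟨ x∙yz≈y∙xz (w h) (w a) _ ⟩
    w a + (w h + FL.weightSum w hs)      ∎
    where open ≤-Reasoning

  w-min-suc : ∀ hs → M * w (foldr _⊓_ c (map suc hs)) ≤ FL.weightSum w hs
  w-min-suc [] = ≤-reflexive (trans (cong (λ e → M * tower e) (n∸n≡0 c)) (*-zeroʳ M))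
  w-min-suc (h ∷ hs) = begin
    M * w (suc h ⊓ foldr _⊓_ c (map suc hs))          ≤⟨ *-monoʳ-≤ M (w-⊓ (suc h) (foldr _⊓_ c (map suc hs))) ⟩
    M * (w (suc h) + w (foldr _⊓_ c (map suc hs)))    ≡⟨ *-distribˡ-+ M (w (suc h)) _ ⟩
    M * w (suc h) + M * w (foldr _⊓_ c (map suc hs))  ≤⟨ +-mono-≤ (w-step h) (w-min-suc hs) ⟩
    w h + FL.weightSum w hs                           ∎
    where open ≤-Reasoning

  raise-step-nonincreasing : ∀ {s t} → Lt.Step RaiseRules s t → W t ≤ W s
  raise-step-nonincreasing = weight-ctx-nonincreasing raise-root
    where
    raise-root : ∀ {s t} → Lt.RootStep RaiseRules s t → W t ≤ W s
    raise-root (_ , _ , (f , h , refl , refl) , σ , refl , refl) = +-monoˡ-≤ _ (w-antitone (n≤1+n h))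

  raise-nonincreasing : ∀ {s t} → RaiseStar s t → W t ≤ W s
  raise-nonincreasing ε = ≤-refl
  raise-nonincreasing (st ◅ sts) = ≤-trans (raise-nonincreasing sts) (raise-step-nonincreasing st)

  -- Common shape of ordinary and raise root steps with rule l → r: the redex
  -- weighs at least W(l) + Σ_{x ∈ vars l} W(σ x), and the contractum is rσ.
  WeighedRootStep : Lt.RuleSet → Rel LTm
  WeighedRootStep Rs s t = ∃ λ l → ∃ λ r → ∃ λ σ →
    Rs l r × W l + FL.varWeight l (W ∘ σ) ≤ W s × t ≡ r Lt.⟨ σ ⟩

  root-step-weighed : ∀ {Rs s t} → Lt.RootStep Rs s t → WeighedRootStep Rs s t
  root-step-weighed (l , r , lr , σ , refl , refl) = l , r , σ , lr , ≤-reflexive (sym (W-subst l σ)) , refl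

  -- In a raise step every matched subterm is raised to σ x, which weighs less.
  raise-root-step-weighed : ∀ {Rs s t} → RaiseRootStep Rs s t → WeighedRootStep Rs s t
  raise-root-step-weighed (l , r , lr , fits , _ , σ , lcr , e) =
    l , r , σ , lr , W-fits (W ∘ σ) fits (λ x u o → raise-nonincreasing (proj₁ (lcr x u o) u o)) , e

  Admissible : B.TRS → Set
  Admissible Rs = ∀ {l r} → (l , r) ∈ Rs →
    (∀ x → ¬ l ≡ var x) × (∀ x → B.occ x r ≤ B.occ x l) × B.fsize r ≤ M

  varWeight-lift : ∀ l' r d φ → (∀ x → B.occ x r ≤ B.occ x (base l')) →
                   FL.varWeight (lift d r) φ ≤ FL.varWeight l' φ
  varWeight-lift l' r d φ nd =
    FL.varWeight-nonDup (lift d r) l' φ (λ x → subst₂ _≤_ (sym (occ-lift x d r)) (sym (occ-base x l')) (nd x))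

  MATCHRT-nonincreasing : ∀ {Bs} → Admissible Bs → ∀ {s t} → WeighedRootStep (MATCHRT c Bs) s t → W t ≤ W s
  MATCHRT-nonincreasing adm (l' , _ , σ , (r , mem , d , height , refl) , redex , refl) = begin
    W (lift d r Lt.⟨ σ ⟩)                               ≡⟨ W-subst (lift d r) σ ⟩
    W (lift d r) + FL.varWeight (lift d r) (W ∘ σ)      ≤⟨ +-mono-≤ (rhs≤lhs height)
                                                          (varWeight-lift l' r d _ (proj₁ (proj₂ (adm mem)))) ⟩
    W l' + FL.varWeight l' (W ∘ σ)                      ≤⟨ redex ⟩
    _                                                   ∎
    where
    open ≤-Reasoning
    rhs≤lhs : MatchRTHeight c l' r d → W (lift d r) ≤ W l'
    rhs≤lhs (inj₁ ((r≤l , uniform) , refl)) =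
      subst₂ _≤_ (sym (W-lift d r)) (trans (sym (W-lift _ (base l'))) (cong W uniform))
        (subst (λ k → B.fsize r * k ≤ B.fsize (base l') * w (rootHeight l')) (sym (w-c⊓ (rootHeight l')))
          (*-monoˡ-≤ (w (rootHeight l')) r≤l))
    rhs≤lhs (inj₂ (_ , refl)) = subst (_≤ W l') (sym (W-lift d r))
      (≤-trans (*-monoˡ-≤ (w d) (proj₂ (proj₂ (adm mem)))) (w-min-suc (heights l')))

  match-decreasing : ∀ {A} → Admissible A → B.NonCollapsing A → ∀ {s t} →
                     WeighedRootStep (Match A) s t → HeightsBoundedBy c t → W t + 1 ≤ W s
  match-decreasing adm nc (var x , _ , σ , (r , mem , refl) , redex , refl) _ = ⊥-elim (proj₁ (adm mem) x refl)
  match-decreasing adm nc (fun _ _ , _ , σ , (var y , mem , refl) , redex , refl) _ = ⊥-elim (nc mem y refl)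
  match-decreasing adm nc (l'@(fun (g , a) ls) , _ , σ , (r@(fun f rs) , mem , refl) , redex , refl) (h<c ∷ _) =
    begin
      W (lift (suc h) r Lt.⟨ σ ⟩) + 1                            ≡⟨ cong (_+ 1) (W-subst (lift (suc h) r) σ) ⟩
      W (lift (suc h) r) + FL.varWeight (lift (suc h) r) σW + 1  ≡⟨ xy∙z≈xz∙y (W (lift (suc h) r)) _ 1 ⟩
      W (lift (suc h) r) + 1 + FL.varWeight (lift (suc h) r) σW  ≤⟨ +-mono-≤ rhs<lhs
                                                                  (varWeight-lift l' r (suc h) _ (proj₁ (proj₂ (adm mem)))) ⟩
      W l' + FL.varWeight l' σW                                  ≤⟨ redex ⟩
      _                                                          ∎
    where
    open ≤-Reasoning
    h : ℕ
    h = minHeight l'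
    σW : ℕ → ℕ
    σW = W ∘ σ
    rhs<lhs : W (lift (suc h) r) + 1 ≤ W l'
    rhs<lhs = begin
      W (lift (suc h) r) + 1       ≡⟨ +-comm _ 1 ⟩
      suc (W (lift (suc h) r))     ≡⟨ cong suc (W-lift (suc h) r) ⟩
      suc (B.fsize r * w (suc h))  ≤⟨ s≤s (*-monoˡ-≤ (w (suc h)) (proj₂ (proj₂ (adm mem)))) ⟩
      suc (M * w (suc h))          ≡⟨ w-below-c h h<c ⟨
      w h                          ≤⟨ w-foldr-⊓ a (heightss ls) ⟩
      W l'                         ∎

-- Raise-reachability is the pointwise order on heights between terms of equal
-- base, so a least common Raise-reduct of equal-base terms is their pointwise
-- maximum.
module RaiseOrder (Sig : Signature) where
  open Signature Sig
  open Over Sig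
  open Lifting Sig

  infix 4 _≤ʰ_ _≤ʰs_

  mutual
    data _≤ʰ_ : LTm → LTm → Set where
      var≤ʰ : ∀ {x} → var x ≤ʰ var x
      fun≤ʰ : ∀ {f a b} {ts us : Vec LTm (arity f)} → a ≤ b → ts ≤ʰs us → fun (f , a) ts ≤ʰ fun (f , b) us

    data _≤ʰs_ : ∀ {n} → Vec LTm n → Vec LTm n → Set where
      [] : [] ≤ʰs []
      _∷_ : ∀ {n t u} {ts us : Vec LTm n} → t ≤ʰ u → ts ≤ʰs us → t ∷ ts ≤ʰs u ∷ us

  mutual
    ≤ʰ-refl : ∀ t → t ≤ʰ t
    ≤ʰ-refl (var x) = var≤ʰ
    ≤ʰ-refl (fun (f , a) ts) = fun≤ʰ ≤-refl (≤ʰs-refl ts)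

    ≤ʰs-refl : ∀ {n} (ts : Vec LTm n) → ts ≤ʰs ts
    ≤ʰs-refl [] = []
    ≤ʰs-refl (t ∷ ts) = ≤ʰ-refl t ∷ ≤ʰs-refl ts

  mutual
    ≤ʰ-trans : ∀ {s t u} → s ≤ʰ t → t ≤ʰ u → s ≤ʰ u
    ≤ʰ-trans var≤ʰ var≤ʰ = var≤ʰ
    ≤ʰ-trans (fun≤ʰ p ps) (fun≤ʰ q qs) = fun≤ʰ (≤-trans p q) (≤ʰs-trans ps qs)

    ≤ʰs-trans : ∀ {n} {s t u : Vec LTm n} → s ≤ʰs t → t ≤ʰs u → s ≤ʰs u
    ≤ʰs-trans [] [] = []
    ≤ʰs-trans (p ∷ ps) (q ∷ qs) = ≤ʰ-trans p q ∷ ≤ʰs-trans ps qs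

  ≤ʰs-update : ∀ {n} (ts : Vec LTm n) i {t} → lookup ts i ≤ʰ t → ts ≤ʰs ts [ i ]≔ t
  ≤ʰs-update (u ∷ ts) fz p = p ∷ ≤ʰs-refl ts
  ≤ʰs-update (u ∷ ts) (fs i) p = ≤ʰ-refl u ∷ ≤ʰs-update ts i p

  raise-step⇒≤ʰ : ∀ {s t} → Lt.Step RaiseRules s t → s ≤ʰ t
  raise-step⇒≤ʰ (Lt.root (_ , _ , (f , a , refl , refl) , σ , refl , refl)) = fun≤ʰ (n≤1+n a) (≤ʰs-refl _)
  raise-step⇒≤ʰ (Lt.cong {ts = ts} i st) = fun≤ʰ ≤-refl (≤ʰs-update ts i (raise-step⇒≤ʰ st))

  raise⇒≤ʰ : ∀ {s t} → RaiseStar s t → s ≤ʰ t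
  raise⇒≤ʰ ε = ≤ʰ-refl _
  raise⇒≤ʰ (st ◅ sts) = ≤ʰ-trans (raise-step⇒≤ʰ st) (raise⇒≤ʰ sts)

  vecSubst : ∀ {n} → Vec LTm n → ℕ → LTm
  vecSubst [] k = var 0
  vecSubst (u ∷ us) zero = u
  vecSubst (u ∷ us) (suc k) = vecSubst us k

  vecSubst-lookup : ∀ {n} (us : Vec LTm n) i → vecSubst us (toℕ i) ≡ lookup us i
  vecSubst-lookup (u ∷ us) fz = refl
  vecSubst-lookup (u ∷ us) (fs i) = vecSubst-lookup us i

  substs-tabulate-var : ∀ {n} (g : Fin n → ℕ) σ → Lt.substs (tabulate (λ i → var (g i))) σ ≡ tabulate (σ ∘ g)
  substs-tabulate-var {zero} g σ = refl
  substs-tabulate-var {suc n} g σ = cong (σ (g fz) ∷_) (substs-tabulate-var (g ∘ fs) σ)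

  vecSubst-instantiates : ∀ {n} (us : Vec LTm n) → Lt.substs (tabulate (λ i → var (toℕ i))) (vecSubst us) ≡ us
  vecSubst-instantiates us = begin
    Lt.substs (tabulate (λ i → var (toℕ i))) (vecSubst us)  ≡⟨ substs-tabulate-var toℕ (vecSubst us) ⟩
    tabulate (vecSubst us ∘ toℕ)                            ≡⟨ VP.tabulate-cong (vecSubst-lookup us) ⟩
    tabulate (lookup us)                                    ≡⟨ VP.tabulate∘lookup us ⟩
    us                                                      ∎
    where open ≡-Reasoning

  raise-root : ∀ f a (us : Vec LTm (arity f)) → Lt.Step RaiseRules (fun (f , a) us) (fun (f , suc a) us)
  raise-root f a us = Lt.root (_ , _ , (f , a , refl , refl) , vecSubst us ,
    cong (fun (f , a)) (sym (vecSubst-instantiates us)) , cong (fun (f , suc a)) (sym (vecSubst-instantiates us)))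

  raise-root-by : ∀ f a k (us : Vec LTm (arity f)) → RaiseStar (fun (f , a) us) (fun (f , k + a) us)
  raise-root-by f a zero us = ε
  raise-root-by f a (suc k) us = raise-root-by f a k us ◅◅ (raise-root f (k + a) us ◅ ε)

  -- Conversely, any pointwise increase of heights is reachable by Raise steps:
  -- first raise the arguments (inside a context F), then the root.
  mutual
    ≤ʰ⇒raise : ∀ {u v} → u ≤ʰ v → RaiseStar u v
    ≤ʰ⇒raise var≤ʰ = ε
    ≤ʰ⇒raise (fun≤ʰ {f} {a} {b} {ts} {us} a≤b ps) =
      ≤ʰs⇒raise (fun (f , a)) (λ i st → Lt.cong i st) ps ◅◅
      subst (λ k → RaiseStar (fun (f , a) us) (fun (f , k) us)) (m∸n+n≡m a≤b) (raise-root-by f a (b ∸ a) us)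

    ≤ʰs⇒raise : ∀ {n} {ts us : Vec LTm n} (F : Vec LTm n → LTm) →
      (∀ {vs} i {t} → Lt.Step RaiseRules (lookup vs i) t → Lt.Step RaiseRules (F vs) (F (vs [ i ]≔ t))) →
      ts ≤ʰs us → RaiseStar (F ts) (F us)
    ≤ʰs⇒raise F inF [] = ε
    ≤ʰs⇒raise {ts = t ∷ ts} {u ∷ us} F inF (p ∷ ps) =
      gmap (λ v → F (v ∷ ts)) (inF fz) (≤ʰ⇒raise p) ◅◅
      ≤ʰs⇒raise (λ vs → F (u ∷ vs)) (λ i → inF (fs i)) ps

  mutual
    data SameBase : LTm → LTm → Set where
      var≈ : ∀ {x} → SameBase (var x) (var x)
      fun≈ : ∀ {f a b} {ts us : Vec LTm (arity f)} → SameBases ts us → SameBase (fun (f , a) ts) (fun (f , b) us)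

    data SameBases : ∀ {n} → Vec LTm n → Vec LTm n → Set where
      [] : SameBases [] []
      _∷_ : ∀ {n t u} {ts us : Vec LTm n} → SameBase t u → SameBases ts us → SameBases (t ∷ ts) (u ∷ us)

  mutual
    sameBase : ∀ u v → base u ≡ base v → SameBase u v
    sameBase (var x) (var .x) refl = var≈
    sameBase (var x) (fun _ _) ()
    sameBase (fun _ _) (var x) ()
    sameBase (fun (f , a) ts) (fun (g , b) us) e with base-fun⁻ e
    ... | refl , es = fun≈ (sameBases ts us es)

    sameBases : ∀ {n} (ts us : Vec LTm n) → bases ts ≡ bases us → SameBases ts us
    sameBases [] [] e = []
    sameBases (t ∷ ts) (u ∷ us) e = sameBase t u (VP.∷-injectiveˡ e) ∷ sameBases ts us (VP.∷-injectiveʳ e)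

  mutual
    _⊔ʰ_ : LTm → LTm → LTm
    var x ⊔ʰ v = var x
    fun (f , a) ts ⊔ʰ var y = fun (f , a) ts
    fun (f , a) ts ⊔ʰ fun (g , b) us = fun (f , a ⊔ b) (ts ⊔ʰs us)

    _⊔ʰs_ : ∀ {n m} → Vec LTm n → Vec LTm m → Vec LTm n
    [] ⊔ʰs _ = []
    (t ∷ ts) ⊔ʰs [] = t ∷ ts
    (t ∷ ts) ⊔ʰs (u ∷ us) = (t ⊔ʰ u) ∷ (ts ⊔ʰs us)

  mutual
    ⊔ʰ-upperˡ : ∀ {u v} → SameBase u v → u ≤ʰ u ⊔ʰ v
    ⊔ʰ-upperˡ var≈ = var≤ʰ
    ⊔ʰ-upperˡ (fun≈ {a = a} {b} ps) = fun≤ʰ (m≤m⊔n a b) (⊔ʰs-upperˡ ps)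

    ⊔ʰs-upperˡ : ∀ {n} {ts us : Vec LTm n} → SameBases ts us → ts ≤ʰs ts ⊔ʰs us
    ⊔ʰs-upperˡ [] = []
    ⊔ʰs-upperˡ (p ∷ ps) = ⊔ʰ-upperˡ p ∷ ⊔ʰs-upperˡ ps

  mutual
    ⊔ʰ-upperʳ : ∀ {u v} → SameBase u v → v ≤ʰ u ⊔ʰ v
    ⊔ʰ-upperʳ var≈ = var≤ʰ
    ⊔ʰ-upperʳ (fun≈ {a = a} {b} ps) = fun≤ʰ (m≤n⊔m a b) (⊔ʰs-upperʳ ps)

    ⊔ʰs-upperʳ : ∀ {n} {ts us : Vec LTm n} → SameBases ts us → us ≤ʰs ts ⊔ʰs us
    ⊔ʰs-upperʳ [] = []
    ⊔ʰs-upperʳ (p ∷ ps) = ⊔ʰ-upperʳ p ∷ ⊔ʰs-upperʳ ps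

  mutual
    ⊔ʰ-least : ∀ {u v w} → u ≤ʰ w → v ≤ʰ w → u ⊔ʰ v ≤ʰ w
    ⊔ʰ-least var≤ʰ var≤ʰ = var≤ʰ
    ⊔ʰ-least (fun≤ʰ p ps) (fun≤ʰ q qs) = fun≤ʰ (⊔-lub p q) (⊔ʰs-least ps qs)

    ⊔ʰs-least : ∀ {n} {ts us ws : Vec LTm n} → ts ≤ʰs ws → us ≤ʰs ws → ts ⊔ʰs us ≤ʰs ws
    ⊔ʰs-least [] [] = []
    ⊔ʰs-least (p ∷ ps) (q ∷ qs) = ⊔ʰ-least p q ∷ ⊔ʰs-least ps qs

  mutual
    base-⊔ʰ : ∀ {u v} → SameBase u v → base (u ⊔ʰ v) ≡ base u
    base-⊔ʰ var≈ = refl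
    base-⊔ʰ (fun≈ {f = f} ps) = cong (fun f) (bases-⊔ʰs ps)

    bases-⊔ʰs : ∀ {n} {ts us : Vec LTm n} → SameBases ts us → bases (ts ⊔ʰs us) ≡ bases ts
    bases-⊔ʰs [] = refl
    bases-⊔ʰs (p ∷ ps) = cong₂ _∷_ (base-⊔ʰ p) (bases-⊔ʰs ps)

  joinList : List LTm → LTm
  joinList [] = var 0
  joinList (u ∷ []) = u
  joinList (u ∷ us@(_ ∷ _)) = u ⊔ʰ joinList us

  module _ {β : Tm} where
    HasBase : LTm → Set
    HasBase v = base v ≡ β

    joinList-base : ∀ us → 0 < length us → All HasBase us → base (joinList us) ≡ β
    joinList-base (u ∷ []) _ (e ∷ []) = e
    joinList-base (u ∷ v ∷ vs) _ (e ∷ es) =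
      trans (base-⊔ʰ (sameBase u _ (trans e (sym (joinList-base (v ∷ vs) (s≤s z≤n) es))))) e

    sameBase-joinList : ∀ u v vs → HasBase u → All HasBase (v ∷ vs) → SameBase u (joinList (v ∷ vs))
    sameBase-joinList u v vs e es = sameBase u _ (trans e (sym (joinList-base (v ∷ vs) (s≤s z≤n) es)))

    joinList-upper : ∀ us → All HasBase us → ∀ {u} → u ∈ us → u ≤ʰ joinList us
    joinList-upper (u ∷ []) _ (here refl) = ≤ʰ-refl u
    joinList-upper (u ∷ v ∷ vs) (e ∷ es) (here refl) = ⊔ʰ-upperˡ (sameBase-joinList u v vs e es)
    joinList-upper (u ∷ v ∷ vs) (e ∷ es) (there m) =
      ≤ʰ-trans (joinList-upper (v ∷ vs) es m) (⊔ʰ-upperʳ (sameBase-joinList u v vs e es))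

  joinList-least : ∀ u us {w} → (∀ {v} → v ∈ u ∷ us → v ≤ʰ w) → joinList (u ∷ us) ≤ʰ w
  joinList-least u [] ub = ub (here refl)
  joinList-least u (v ∷ vs) ub = ⊔ʰ-least (ub (here refl)) (joinList-least v vs (ub ∘ there))

  joinList-singleton : ∀ us {u} → length us ≤ 1 → u ∈ us → joinList us ≡ u
  joinList-singleton (u ∷ []) _ (here refl) = refl
  joinList-singleton (u ∷ v ∷ vs) (s≤s ()) _

  joinList-lcr : ∀ {β} (P : LTm → Set) us → (∀ {v} → P v → v ∈ us) → (∀ {v} → v ∈ us → P v) →
                 All (HasBase {β}) us → ∀ {u} → P u → LeastCommonRaiseReduct P (joinList us)
  joinList-lcr P [] complete sound bs pu with complete pu
  ... | ()
  joinList-lcr P (v ∷ vs) complete sound bs pu =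
    (λ u' pu' → ≤ʰ⇒raise (joinList-upper (v ∷ vs) bs (complete pu'))) ,
    (λ w reach → ≤ʰ⇒raise (joinList-least v vs (λ m → raise⇒≤ʰ (reach _ (sound m)))))

-- Every rewrite step on base terms lifts to a step of match(A) / MATCHRT^c(B)
-- (an ordinary step for linear rules, a ⇝-step in general) from any lifting
-- of its source, ending in a lifting of its target.
module Simulation (Sig : Signature) where
  open Signature Sig
  open Over Sig
  open Lifting Sig
  open RaiseOrder Sig

  -- A lifting s' of an instance lσ consists of a lifting lhs of l whose
  -- variable positions in s' hold liftings of the σ x.
  record Decomposition (l : Tm) (σ : ℕ → Tm) (s' : LTm) : Set where
    field
      lhs : LTm
      lhs-base : base lhs ≡ l
      fits : Fits lhs s'
      matched-base : ∀ x u → Occ lhs s' x u → base u ≡ σ x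

  record Decompositions {n} (ls : Vec Tm n) (σ : ℕ → Tm) (ss : Vec LTm n) : Set where
    field
      lhss : Vec LTm n
      lhss-base : bases lhss ≡ ls
      fits : ∀ i → Fits (lookup lhss i) (lookup ss i)
      matched-base : ∀ i x u → Occ (lookup lhss i) (lookup ss i) x u → base u ≡ σ x

  mutual
    decompose : ∀ l σ s' → base s' ≡ l B.⟨ σ ⟩ → Decomposition l σ s'
    decompose (var x) σ s' e = record { lhs = var x ; lhs-base = refl ; fits = fvar ;
                                        matched-base = λ { .x .s' ovar → e } }
    decompose (fun f ls) σ (var y) ()
    decompose (fun f ls) σ (fun (g , h) ss) e with base-fun⁻ e
    ... | refl , es = let open Decompositions (decomposes ls σ ss es) in
      record { lhs = fun (f , h) lhss ; lhs-base = cong (fun f) lhss-base ;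
               fits = ffun fits ; matched-base = λ { x u (ofun i o) → matched-base i x u o } }

    decomposes : ∀ {n} (ls : Vec Tm n) σ (ss : Vec LTm n) → bases ss ≡ B.substs ls σ → Decompositions ls σ ss
    decomposes [] σ [] e = record { lhss = [] ; lhss-base = refl ; fits = λ () ; matched-base = λ () }
    decomposes (l ∷ ls) σ (s ∷ ss) e =
      let module D = Decomposition (decompose l σ s (VP.∷-injectiveˡ e))
          module Ds = Decompositions (decomposes ls σ ss (VP.∷-injectiveʳ e)) in
      record { lhss = D.lhs ∷ Ds.lhss ;
               lhss-base = cong₂ _∷_ D.lhs-base Ds.lhss-base ;
               fits = λ { fz → D.fits ; (fs i) → Ds.fits i } ;
               matched-base = λ { fz → D.matched-base ; (fs i) → Ds.matched-base i } }

  mutual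
    occurrences : LTm → LTm → ℕ → List LTm
    occurrences (var y) s x with x ≟ y
    ... | yes _ = s ∷ []
    ... | no _ = []
    occurrences (fun f ts) (var _) x = []
    occurrences (fun f ts) (fun g us) x = occurrencess ts us x

    occurrencess : ∀ {n m} → Vec LTm n → Vec LTm m → ℕ → List LTm
    occurrencess [] _ x = []
    occurrencess (t ∷ ts) [] x = []
    occurrencess (t ∷ ts) (u ∷ us) x = occurrences t u x ++ occurrencess ts us x

  mutual
    occurrences-complete : ∀ {l s x u} → Occ l s x u → u ∈ occurrences l s x
    occurrences-complete {var x} {s} {.x} ovar with x ≟ x
    ... | yes _ = here refl
    ... | no x≢x = ⊥-elim (x≢x refl)
    occurrences-complete {fun f ts} {fun .f us} (ofun i o) = occurrencess-complete ts us i o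

    occurrencess-complete : ∀ {n x u} (ts us : Vec LTm n) i → Occ (lookup ts i) (lookup us i) x u →
                            u ∈ occurrencess ts us x
    occurrencess-complete (t ∷ ts) (u ∷ us) fz o = ∈-++⁺ˡ (occurrences-complete {t} {u} o)
    occurrencess-complete (t ∷ ts) (u ∷ us) (fs i) o = ∈-++⁺ʳ (occurrences t u _) (occurrencess-complete ts us i o)

  mutual
    occurrences-sound : ∀ {l s x u} → Fits l s → u ∈ occurrences l s x → Occ l s x u
    occurrences-sound {var y} {s} {x} fvar m with x ≟ y
    occurrences-sound {var y} {s} {.y} fvar (here refl) | yes refl = ovar
    occurrences-sound {var y} {s} {x} fvar () | no _
    occurrences-sound {fun f ts} {fun .f us} (ffun fits) m =
      let (i , o) = occurrencess-sound ts us fits m in ofun i o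

    occurrencess-sound : ∀ {n x u} (ts us : Vec LTm n) → (∀ i → Fits (lookup ts i) (lookup us i)) →
                         u ∈ occurrencess ts us x → Σ (Fin n) λ i → Occ (lookup ts i) (lookup us i) x u
    occurrencess-sound {x = x} (t ∷ ts) (u ∷ us) fits m with ∈-++⁻ (occurrences t u x) m
    ... | inj₁ m₁ = fz , occurrences-sound {t} {u} (fits fz) m₁
    ... | inj₂ m₂ = let (i , o) = occurrencess-sound ts us (fits ∘ fs) m₂ in fs i , o

  mutual
    length-occurrences : ∀ {l s} x → Fits l s → length (occurrences l s x) ≡ Lt.occ x l
    length-occurrences {var y} x fvar with x ≟ y
    ... | yes _ = refl
    ... | no _ = refl
    length-occurrences {fun f ts} {fun .f us} x (ffun fits) = length-occurrencess x ts us fits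

    length-occurrencess : ∀ {n} x (ts us : Vec LTm n) → (∀ i → Fits (lookup ts i) (lookup us i)) →
                          length (occurrencess ts us x) ≡ Lt.occs x ts
    length-occurrencess x [] [] fits = refl
    length-occurrencess x (t ∷ ts) (u ∷ us) fits =
      trans (LP.length-++ (occurrences t u x))
            (cong₂ _+_ (length-occurrences {t} {u} x (fits fz)) (length-occurrencess x ts us (fits ∘ fs)))

  mutual
    fits-subst : ∀ {l s} σ → Fits l s → (∀ x u → Occ l s x u → σ x ≡ u) → l Lt.⟨ σ ⟩ ≡ s
    fits-subst {var x} {s} σ fvar h = h x s ovar
    fits-subst {fun f ts} {fun .f us} σ (ffun fits) h = cong (fun f) (fits-substs σ ts us fits (λ i x u o → h x u (ofun i o)))

    fits-substs : ∀ {n} σ (ts us : Vec LTm n) → (∀ i → Fits (lookup ts i) (lookup us i)) →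
                  (∀ i x u → Occ (lookup ts i) (lookup us i) x u → σ x ≡ u) → Lt.substs ts σ ≡ us
    fits-substs σ [] [] fits h = refl
    fits-substs σ (t ∷ ts) (u ∷ us) fits h =
      cong₂ _∷_ (fits-subst {t} {u} σ (fits fz) (h fz)) (fits-substs σ ts us (fits ∘ fs) (h ∘ fs))

  -- Lifting a root step lσ → rσ (Var(r) ⊆ Var(l)) from a lifting s' of lσ:
  -- the lifted rule is l' → lift d r with l' the pattern of s', and the
  -- substitution sends x to the maximum of the subterms matched by x.
  module LiftRootStep (l r : Tm) (σ : ℕ → Tm) (var-incl : ∀ x → 0 < B.occ x r → 0 < B.occ x l)
                      (s' : LTm) (s'-base : base s' ≡ l B.⟨ σ ⟩) where
    open Decomposition (decompose l σ s' s'-base) public using (lhs; lhs-base)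
    open Decomposition (decompose l σ s' s'-base) using (fits; matched-base)

    matched : ℕ → List LTm
    matched x = occurrences lhs s' x

    σ' : ℕ → LTm
    σ' x = joinList (matched x)

    matched-base-all : ∀ x → All (HasBase {σ x}) (matched x)
    matched-base-all x = All.tabulate (λ m → matched-base x _ (occurrences-sound fits m))

    length-matched : ∀ x → length (matched x) ≡ B.occ x l
    length-matched x = trans (length-occurrences x fits) (trans (occ-base x lhs) (cong (B.occ x) lhs-base))

    σ'-lcr : ∀ x u → Occ lhs s' x u → LeastCommonRaiseReduct (λ v → Occ lhs s' x v) (σ' x)
    σ'-lcr x u o = joinList-lcr _ (matched x) occurrences-complete (occurrences-sound fits) (matched-base-all x) o

    matched-same-base : ∀ x u₁ u₂ → Occ lhs s' x u₁ → Occ lhs s' x u₂ → base u₁ ≡ base u₂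
    matched-same-base x u₁ u₂ o₁ o₂ = trans (matched-base x u₁ o₁) (sym (matched-base x u₂ o₂))

    contractum-base : ∀ d → base (lift d r Lt.⟨ σ' ⟩) ≡ r B.⟨ σ ⟩
    contractum-base d = base-lift-subst d r σ' σ λ x x∈r →
      joinList-base (matched x) (subst (0 <_) (sym (length-matched x)) (var-incl x x∈r)) (matched-base-all x)

    lhs-instantiates : (∀ x → B.occ x l ≤ 1) → lhs Lt.⟨ σ' ⟩ ≡ s'
    lhs-instantiates linear = fits-subst σ' fits λ x u o →
      joinList-singleton (matched x) (subst (_≤ 1) (sym (length-matched x)) (linear x)) (occurrences-complete o)

    raise-step : ∀ {Rs : Lt.RuleSet} d → Rs lhs (lift d r) →
                 Σ LTm λ t' → base t' ≡ r B.⟨ σ ⟩ × RaiseRootStep Rs s' t'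
    raise-step d rule = lift d r Lt.⟨ σ' ⟩ , contractum-base d ,
                        (lhs , lift d r , rule , fits , matched-same-base , σ' , σ'-lcr , refl)

    linear-step : (∀ x → B.occ x l ≤ 1) → ∀ {Rs : Lt.RuleSet} d → Rs lhs (lift d r) →
                  Σ LTm λ t' → base t' ≡ r B.⟨ σ ⟩ × Lt.RootStep Rs s' t'
    linear-step linear d rule = lift d r Lt.⟨ σ' ⟩ , contractum-base d ,
                                (lhs , lift d r , rule , σ' , sym (lhs-instantiates linear) , refl)

  LiftsTo : Rel Tm → Rel LTm → Set
  LiftsTo Root Root' = ∀ {s t} s' → Root s t → base s' ≡ s → Σ LTm λ t' → base t' ≡ t × Root' s' t'

  lift-ctx : ∀ {Root Root'} → LiftsTo Root Root' → LiftsTo (B.Ctx Root) (Lt.Ctx Root')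
  lift-ctx lr s' (B.root r) e = let (t' , t'-base , r') = lr s' r e in t' , t'-base , Lt.root r'
  lift-ctx lr (var y) (B.cong i st) ()
  lift-ctx lr (fun (g , h) ss) (B.cong i st) e with base-fun⁻ e
  ... | refl , refl with lift-ctx lr (lookup ss i) st (sym (lookup-bases ss i))
  ... | t' , t'-base , st' = fun (g , h) (ss [ i ]≔ t') ,
                             cong (fun g) (trans (bases-update ss i t') (cong (bases ss [ i ]≔_) t'-base)) ,
                             Lt.cong i st'

  match-rule : ∀ {A l r} → (l , r) ∈ A → ∀ l' → base l' ≡ l → Match A l' (lift (suc (minHeight l')) r)
  match-rule {A} {l} {r} mem l' e = r , subst (λ k → (k , r) ∈ A) (sym e) mem , refl

  MATCHRT-rule : ∀ c {Bs l r} → (l , r) ∈ Bs → ∀ l' → base l' ≡ l → Σ ℕ λ d → MATCHRT c Bs l' (lift d r)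
  MATCHRT-rule c {Bs} {l} {r} mem l' e with (B.fsize r ≤? B.fsize (base l')) ×-dec uniform? (rootHeight l') l'
  ... | yes p = c ⊓ rootHeight l' , r , subst (λ k → (k , r) ∈ Bs) (sym e) mem , _ , inj₁ (p , refl) , refl
  ... | no ¬p = _ , r , subst (λ k → (k , r) ∈ Bs) (sym e) mem , _ , inj₂ (¬p , refl) , refl

module Soundness (Sig : Signature) where
  open Signature Sig
  open Over Sig
  open Lifting Sig
  open Simulation Sig

  data Derivation (R₁ R₂ S : B.TRS) : Tm → Tm → ℕ → ℕ → Set where
    done : ∀ {s} → Derivation R₁ R₂ S s s 0 0
    S-step : ∀ {s t u a b} → B.Step (B.rules S) s t → Derivation R₁ R₂ S t u a b → Derivation R₁ R₂ S s u a b
    R₁-step : ∀ {s t u a b} → B.Step (B.rules R₁) s t → Derivation R₁ R₂ S t u a b → Derivation R₁ R₂ S s u (suc a) b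
    R₂-step : ∀ {s t u a b} → B.Step (B.rules R₂) s t → Derivation R₁ R₂ S t u a b → Derivation R₁ R₂ S s u a (suc b)

  S-steps : ∀ {R₁ R₂ S s y u a b} → Star (B.Step (B.rules S)) s y → Derivation R₁ R₂ S y u a b →
            Derivation R₁ R₂ S s u a b
  S-steps ε d = d
  S-steps (st ◅ sts) d = S-step st (S-steps sts d)

  step-∪ : ∀ {R R₁ R₂} → R ≐ R₁ ∪ R₂ → ∀ {s t} → B.Step (B.rules R) s t →
           B.Step (B.rules R₁) s t ⊎ B.Step (B.rules R₂) s t
  step-∪ R≐ = FB.ctx-split λ { (l , r , mem , σ , e₁ , e₂) → ⊎-map
    (λ m → l , r , m , σ , e₁ , e₂) (λ m → l , r , m , σ , e₁ , e₂) (proj₁ (R≐ (l , r)) mem) }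

  derivation-split : ∀ {R S R₁ R₂} → R ≐ R₁ ∪ R₂ → ∀ k {t u} → Iter (RelRew R S) k t u →
                     Σ ℕ λ a → Σ ℕ λ b → a + b ≡ k × Derivation R₁ R₂ S t u a b
  derivation-split R≐ zero refl = 0 , 0 , refl , done
  derivation-split R≐ (suc k) (_ , (_ , before , (_ , st , after)) , rest)
    with derivation-split R≐ k rest | step-∪ R≐ st
  ... | a , b , a+b≡k , d | inj₁ st₁ =
    suc a , b , cong suc a+b≡k , S-steps before (R₁-step st₁ (S-steps after d))
  ... | a , b , a+b≡k , d | inj₂ st₂ =
    a , suc b , trans (+-suc a b) (cong suc a+b≡k) , S-steps before (R₂-step st₂ (S-steps after d))

  prepend : ∀ {R₁ R₂S s t u a} → B.Step (B.rules R₂S) s t → Iter (RelRew R₁ R₂S) (suc a) t u →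
            Iter (RelRew R₁ R₂S) (suc a) s u
  prepend st (z , (y , before , step) , rest) = z , (y , st ◅ before , step) , rest

  R₁-derivation : ∀ {R₁ R₂ S t u a b} → Derivation R₁ R₂ S t u a b →
                  Σ Tm λ u' → Iter (RelRew R₁ (R₂ ++ S)) a t u'
  R₁-derivation {t = t} done = t , refl
  R₁-derivation {t = t} {a = zero} (S-step st d) = t , refl
  R₁-derivation {R₂ = R₂} {a = suc a} (S-step st d) = map₂ (prepend (FB.step-⊆ (∈-++⁺ʳ R₂) st)) (R₁-derivation d)
  R₁-derivation {t = t} {a = zero} (R₂-step st d) = t , refl
  R₁-derivation {a = suc a} (R₂-step st d) = map₂ (prepend (FB.step-⊆ ∈-++⁺ˡ st)) (R₁-derivation d)
  R₁-derivation {t = t} (R₁-step {t = t'} st d) with R₁-derivation d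
  ... | u' , it = u' , (t' , (t , ε , (t' , st , ε)) , it)

  module Counting (R₁ R₂ S : B.TRS) (L : Tm → Set) (trs₁ : B.IsTRS R₁) (trs₂ : B.IsTRS R₂) (trsS : B.IsTRS S)
    (c : ℕ) (W : LTm → ℕ) (A' B' : Rel LTm)
    (bounded : Lt.SuccSat (Lt.RelStep A' B') (Lift0 L) (HeightsBoundedBy c))
    (lift-A : LiftsTo (B.Step (B.rules R₂)) A')
    (lift-B : LiftsTo (B.Step (B.rules (R₁ ++ S))) B')
    (A'-decreasing : ∀ {s t} → A' s t → HeightsBoundedBy c t → W t + 1 ≤ W s)
    (B'-nonincreasing : ∀ {s t} → B' s t → W t ≤ W s) where

    -- Invariant: s' lies over the current term s and is reachable from
    -- lift₀(t₀), the last A'-step being followed by B'-steps only.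
    R₂-steps≤weight : ∀ {t₀ s u a b} → L t₀ → Derivation R₁ R₂ S s u a b → B.Ground s →
                      ∀ {p' s'} → base s' ≡ s → Star (Lt.RelStep A' B') (lift 0 t₀) p' → Star B' p' s' →
                      b ≤ W s'
    R₂-steps≤weight t₀∈L done g s'-base reach since = z≤n
    R₂-steps≤weight t₀∈L (S-step st d) g {s' = s'} s'-base reach since with lift-B s' (FB.step-⊆ (∈-++⁺ʳ R₁) st) s'-base
    ... | t' , t'-base , st' =
      ≤-trans (R₂-steps≤weight t₀∈L d (FB.ground-step S trsS g st) t'-base reach (since ◅◅ (st' ◅ ε)))
              (B'-nonincreasing st')
    R₂-steps≤weight t₀∈L (R₁-step st d) g {s' = s'} s'-base reach since with lift-B s' (FB.step-⊆ ∈-++⁺ˡ st) s'-base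
    ... | t' , t'-base , st' =
      ≤-trans (R₂-steps≤weight t₀∈L d (FB.ground-step R₁ trs₁ g st) t'-base reach (since ◅◅ (st' ◅ ε)))
              (B'-nonincreasing st')
    R₂-steps≤weight {t₀} t₀∈L (R₂-step {t = t} st d) g {s' = s'} s'-base reach since with lift-A s' st s'-base
    ... | t' , t'-base , st' =
      ≤-trans (s≤s (R₂-steps≤weight t₀∈L d t-ground t'-base reach' ε))
              (subst (_≤ W s') (+-comm (W t') 1) (A'-decreasing st' t'-bounded))
      where
      t-ground : B.Ground t
      t-ground = FB.ground-step R₂ trs₂ g st
      reach' : Star (Lt.RelStep A' B') (lift 0 t₀) t'
      reach' = reach ◅◅ ((s' , since , (t' , st' , ε)) ◅ ε)
      t'-bounded : HeightsBoundedBy c t'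
      t'-bounded = bounded (lift 0 t₀) t' (t₀ , t₀∈L , refl) reach'
                           (ground-base⁻ t' (subst B.Ground (sym t'-base) t-ground))

    R₂-steps≤lift₀-weight : ∀ {t u a b} → L t → B.Ground t → Derivation R₁ R₂ S t u a b → b ≤ W (lift 0 t)
    R₂-steps≤lift₀-weight t∈L g d = R₂-steps≤weight t∈L d g (base-lift 0 _) ε ε

  R₂StepsLinear : B.TRS → B.TRS → B.TRS → (Tm → Set) → Set
  R₂StepsLinear R₁ R₂ S L = Σ ℕ λ K → ∀ {t u a b} → L t → B.Ground t → Derivation R₁ R₂ S t u a b → b ≤ B.fsize t * K

  -- Both bounding conditions yield a linear bound, via the weight of
  -- Potential with M the largest right-hand side size and c the height bound.
  module LinearBound (R₁ R₂ S : B.TRS) (L : Tm → Set) (trs₁ : B.IsTRS R₁) (trs₂ : B.IsTRS R₂) (trsS : B.IsTRS S)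
    (nc : B.NonCollapsing R₂) (nd : B.NonDuplicating (R₂ ++ (R₁ ++ S))) (c : ℕ) where

    open Potential Sig (FB.maxRhsSize (R₂ ++ (R₁ ++ S))) c

    trs₁S : B.IsTRS (R₁ ++ S)
    trs₁S = FB.isTRS-++ trs₁ trsS

    admissible : Admissible (R₂ ++ (R₁ ++ S))
    admissible m = proj₁ (FB.isTRS-++ trs₂ trs₁S m) , nd m , FB.rhsSize≤max m

    count : ∀ (A' B' : Rel LTm) → Lt.SuccSat (Lt.RelStep A' B') (Lift0 L) (HeightsBoundedBy c) →
            LiftsTo (B.Step (B.rules R₂)) A' → LiftsTo (B.Step (B.rules (R₁ ++ S))) B' →
            (∀ {s t} → A' s t → HeightsBoundedBy c t → W t + 1 ≤ W s) →
            (∀ {s t} → B' s t → W t ≤ W s) → R₂StepsLinear R₁ R₂ S L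
    count A' B' bounded lift-A lift-B A'-dec B'-dec = w 0 , λ {t} t∈L g d →
      subst (_ ≤_) (W-lift 0 t) (R₂-steps≤lift₀-weight t∈L g d)
      where open Counting R₁ R₂ S L trs₁ trs₂ trsS c W A' B' bounded lift-A lift-B A'-dec B'-dec

    match-step-decreasing : ∀ {Root} → (∀ {s t} → Root s t → WeighedRootStep (Match R₂) s t) →
                            ∀ {s t} → Lt.Ctx Root s t → HeightsBoundedBy c t → W t + 1 ≤ W s
    match-step-decreasing weighed =
      weight-ctx 1 λ {s} {t} r → match-decreasing (admissible ∘ ∈-++⁺ˡ) nc {s} {t} (weighed r)

    MATCHRT-step-nonincreasing : ∀ {Root} → (∀ {s t} → Root s t → WeighedRootStep (MATCHRT c (R₁ ++ S)) s t) →
                                 ∀ {s t} → Lt.Ctx Root s t → W t ≤ W s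
    MATCHRT-step-nonincreasing weighed =
      weight-ctx-nonincreasing λ {s} {t} r → MATCHRT-nonincreasing (admissible ∘ ∈-++⁺ʳ R₂) {s} {t} (weighed r)

    linear-case : B.Linear (R₂ ++ (R₁ ++ S)) →
                  Lt.SuccSat (MatchRTStep R₂ (R₁ ++ S) c) (Lift0 L) (HeightsBoundedBy c) → R₂StepsLinear R₁ R₂ S L
    linear-case lin bounded = count (Lt.Step (Match R₂)) (Lt.Step (MATCHRT c (R₁ ++ S))) bounded
      (lift-ctx lift-R₂) (lift-ctx lift-R₁S)
      (match-step-decreasing root-step-weighed) (MATCHRT-step-nonincreasing root-step-weighed)
      where
      lift-R₂ : LiftsTo (B.RootStep (B.rules R₂)) (Lt.RootStep (Match R₂))
      lift-R₂ s' (l , r , m , σ , refl , refl) e = let open LiftRootStep l r σ (proj₂ (trs₂ m)) s' e in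
        linear-step (λ x → proj₁ (lin (∈-++⁺ˡ m) x)) (suc (minHeight lhs)) (match-rule m lhs lhs-base)
      lift-R₁S : LiftsTo (B.RootStep (B.rules (R₁ ++ S))) (Lt.RootStep (MATCHRT c (R₁ ++ S)))
      lift-R₁S s' (l , r , m , σ , refl , refl) e = let open LiftRootStep l r σ (proj₂ (trs₁S m)) s' e in
        linear-step (λ x → proj₁ (lin (∈-++⁺ʳ R₂ m) x)) (proj₁ (MATCHRT-rule c m lhs lhs-base))
                    (proj₂ (MATCHRT-rule c m lhs lhs-base))

    raise-case : Lt.SuccSat (MatchRaiseRTStep R₂ (R₁ ++ S) c) (Lift0 L) (HeightsBoundedBy c) → R₂StepsLinear R₁ R₂ S L
    raise-case bounded = count (RaiseStep (Match R₂)) (RaiseStep (MATCHRT c (R₁ ++ S))) bounded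
      (lift-ctx lift-R₂) (lift-ctx lift-R₁S)
      (match-step-decreasing raise-root-step-weighed) (MATCHRT-step-nonincreasing raise-root-step-weighed)
      where
      lift-R₂ : LiftsTo (B.RootStep (B.rules R₂)) (RaiseRootStep (Match R₂))
      lift-R₂ s' (l , r , m , σ , refl , refl) e = let open LiftRootStep l r σ (proj₂ (trs₂ m)) s' e in
        raise-step (suc (minHeight lhs)) (match-rule m lhs lhs-base)
      lift-R₁S : LiftsTo (B.RootStep (B.rules (R₁ ++ S))) (RaiseRootStep (MATCHRT c (R₁ ++ S)))
      lift-R₁S s' (l , r , m , σ , refl , refl) e = let open LiftRootStep l r σ (proj₂ (trs₁S m)) s' e in
        raise-step (proj₁ (MATCHRT-rule c m lhs lhs-base)) (proj₂ (MATCHRT-rule c m lhs lhs-base))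

  split-isTRS : ∀ {R R₁ R₂} → R ≐ R₁ ∪ R₂ → B.IsTRS R → B.IsTRS R₁ × B.IsTRS R₂
  split-isTRS R≐ trs = (λ m → trs (proj₂ (R≐ _) (inj₁ m))) , (λ m → trs (proj₂ (R≐ _) (inj₂ m)))

  R₂-steps-linear : ∀ {R S L R₁ R₂} → ValidProblem ⟨ R / S , L ⟩ → SplitCond ⟨ R / S , L ⟩ R₁ R₂ →
                    R₂StepsLinear R₁ R₂ S L
  R₂-steps-linear {R} {S} {L} {R₁} {R₂} (trsR , trsS , _) (R≐ , nc , bounded) with split-isTRS R≐ trsR | bounded
  ... | trs₁ , trs₂ | inj₁ (lin , c , matchRT-bounded) =
    let open LinearBound R₁ R₂ S L trs₁ trs₂ trsS nc nd c in linear-case lin matchRT-bounded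
    where
    nd : B.NonDuplicating (R₂ ++ (R₁ ++ S))
    nd = FB.linear⇒nonDuplicating (FB.isTRS-++ trs₂ (FB.isTRS-++ trs₁ trsS)) lin
  ... | trs₁ , trs₂ | inj₂ (nd , c , matchRaiseRT-bounded) =
    let open LinearBound R₁ R₂ S L trs₁ trs₂ trsS nc nd c in raise-case matchRaiseRT-bounded

  split-arithmetic : ∀ K n B {a b} → a ≤ B → b ≤ n * K → a + b ≤ suc K * ((n + 0) + (B + 0))
  split-arithmetic K n B {a} {b} a≤B b≤nK rewrite +-identityʳ n | +-identityʳ B = begin
    a + b              ≤⟨ +-mono-≤ a≤B b≤nK ⟩
    B + n * K          ≤⟨ +-mono-≤ (m≤n+m B n) (*-monoˡ-≤ K (m≤m+n n B)) ⟩
    (n + B) + (n + B) * K ≡⟨ cong ((n + B) +_) (*-comm (n + B) K) ⟩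
    suc K * (n + B)    ∎
    where open ≤-Reasoning

  -- Soundness of the output {(R₁/(R₂ ∪ S), L, n ↦ n)}: a →_{R/S} derivation
  -- of length k = a + b from t has a ≤ cp(n, R₁/(R₂ ∪ S)) and b ≤ K·‖t‖ ≤ K·n.
  split-sound : ∀ {R S L R₁ R₂} → ValidProblem ⟨ R / S , L ⟩ → SplitCond ⟨ R / S , L ⟩ R₁ R₂ →
                SoundFor ⟨ R / S , L ⟩ (⟪ ⟨ R₁ / R₂ ++ S , L ⟩ , (λ n → n) ⟫ ∷ [])
  split-sound valid@(_ , _ , ground) cond@(R≐ , _) with R₂-steps-linear valid cond
  ... | K , R₂-bound = suc K , 0 , bound
    where
    bound : ∀ n → 0 ≤ n → ∀ b → (∀ i → CpBoundedBy _ n (b i)) → CpBoundedBy _ n (suc K * ((n + 0) + (b fz + 0)))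
    bound n _ b R₁-bound t t∈L |t|≤n k u d with derivation-split R≐ k d
    ... | a , b' , refl , d' =
      split-arithmetic K n (b fz) (R₁-bound fz t t∈L |t|≤n a _ (proj₂ (R₁-derivation d')))
        (≤-trans (R₂-bound t∈L (ground t t∈L) d') (*-monoˡ-≤ K (≤-trans (FB.fsize≤size t) |t|≤n)))

  identity-sound : ∀ P → SoundFor P (⟪ P , (λ _ → 0) ⟫ ∷ [])
  identity-sound P = 1 , 0 , λ n _ b bounded t t∈L |t|≤n k u d →
    ≤-trans (bounded fz t t∈L |t|≤n k u d) (≤-reflexive (sym (trans (*-identityˡ _) (+-identityʳ (b fz)))))

theorem7p5 : (Sig : Signature) → (Φ : Over.Processor Sig) →
    Over.IsMatchRTProcessor Sig Φ → Over.SoundProcessor Sig Φ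
theorem7p5 Sig Φ isΦ P valid with isΦ P valid
... | inj₁ (R₁ , R₂ , cond , Φ≡) rewrite Φ≡ = Soundness.split-sound Sig valid cond
... | inj₂ (_ , Φ≡) rewrite Φ≡ = Soundness.identity-sound Sig P
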